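{- Let $p>3$ be a prime. Then $$\sum_{k=0}^{p-1}\frac{T_k}{3^k}\equiv\begin{cases}p\pmod{p^2}&\text{if }p\equiv1\pmod 3,\\ 0\pmod{p^2}&\text{if }p\equiv 2\pmod 3.\end{cases}$$
   Context: $T_k$ denotes the central trinomial coefficient, i.e. the constant term of $(1+x+x^{ -1})^k$. Congruences of rationals with denominators prime to $p$ are understood in the ring of rationals with denominator prime to $p$. -}

module Defs where

open import Data.Nat using (ℕ; zero; suc; _+_; _*_; _^_; NonZero)
open import Data.Nat.Properties using (m^n≢0)
open import Data.Nat.Divisibility using (_∣_; _∤_)
open import Data.Product using (_×_)
open import Data.List using (List; []; _∷_; zipWith; lookup; length)
import Data.Integer as ℤ
open import Data.Rational as ℚ using (ℚ; ↥_; ↧ₙ_)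

-- Laurent polynomials in x, stored as coefficient lists with the convention
-- that the list for (1+x+x⁻¹)^k has length 2k+1 and entry i is the
-- coefficient of x^(i-k).

-- multiply a coefficient list [c_0..c_{2k}] (exponents -k..k) by (1+x+x⁻¹),
-- giving [d_0..d_{2k+2}] (exponents -(k+1)..k+1) with
-- d_j = c_{j-2} + c_{j-1} + c_j  (missing entries are 0)
add3 : List ℕ → List ℕ → List ℕ → List ℕ
add3 (a ∷ as) (b ∷ bs) (c ∷ cs) = (a + b + c) ∷ add3 as bs cs
add3 _ _ _ = []

mulTri : List ℕ → List ℕ
mulTri cs = add3 (0 ∷ 0 ∷ cs) (0 ∷ cs ++0) (cs ++0 ++0)
  where
  _++0 : List ℕ → List ℕ
  [] ++0 = 0 ∷ []
  (x ∷ xs) ++0 = x ∷ (xs ++0)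

triPow : ℕ → List ℕ
triPow zero = 1 ∷ []
triPow (suc k) = mulTri (triPow k)

nth : List ℕ → ℕ → ℕ
nth [] _ = 0
nth (x ∷ xs) zero = x
nth (x ∷ xs) (suc i) = nth xs i

-- central trinomial coefficient: constant term of (1+x+x⁻¹)^k
T : ℕ → ℕ
T k = nth (triPow k) k

sumℚ : ℕ → (ℕ → ℚ) → ℚ
sumℚ zero f = ℚ.0ℚ
sumℚ (suc n) f = sumℚ n f ℚ.+ f n

term : ℕ → ℚ
term k = (ℤ.+ T k ℚ./ (3 ^ k)) {{m^n≢0 3 k}}

-- congruence of rationals modulo m in the ring of rationals whose denominator
-- is prime to p: both sides have denominators prime to p, and the difference
-- a - b (in lowest terms) has numerator divisible by m.
CongMod : (p m : ℕ) → ℚ → ℚ → Set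
CongMod p m a b = (p ∤ ↧ₙ a) × (p ∤ ↧ₙ b) × (m ∣ ℤ.∣ (↥ (a ℚ.- b)) ∣)

module Submission where

-- Since 1 + x + x⁻¹ = 3 + (x^½ - x^-½)², T_k = ∑ⱼ C(k,j) 3^(k-j) (-1)ʲ C(2j,j). Summing against 3^(p-k)
-- and using the hockey-stick identity, 3ᵖ ∑_{k<p} T_k / 3ᵏ = ∑_{j<p} C(p,j+1) 3^(p-j) (-1)ʲ C(2j,j),
-- and each summand is p · 3^(p-j) (-1)ʲ D_j with D_j = C(p,j+1) C(2j,j) / p an integer. For p = 2n+1,
-- modulo p: C(2j,j) ≡ (-4)ʲ C(n,j) for j ≤ n, C(2j,j) ≡ 0 for n < j ≤ 2n, and D_{2n} ≡ -1; the binomial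
-- theorem then gives ∑ⱼ 3^(p-j) (-1)ʲ D_j ≡ 3 (1 + ε) / 2 with ε = (-3)ⁿ. Finally (1 + √-3)³ = -8 and
-- Fermat's little theorem show ε ≡ 1 if p ≡ 1 (mod 3) and ε ≡ -1 if p ≡ 2 (mod 3).

open import Defs
open import Data.Nat using (ℕ; _>_; _^_; _%_)
open import Data.Nat.Primality using (Prime)
open import Data.Product using (_×_)
open import Relation.Binary.PropositionalEquality using (_≡_)
import Data.Integer as ℤ
open import Data.Rational using (ℚ; 0ℚ)

open import Data.Nat as ℕ using (zero; suc; _≤_; _<_; z≤n; s≤s; NonZero)
import Data.Nat.Properties as ℕP
open import Data.Nat.Combinatorics using (_C_; nCn≡1; nC1≡n; nCk≡nC[n∸k]; nCk+nC[k+1]≡[n+1]C[k+1]; k>n⇒nCk≡0)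
open import Data.Nat.Divisibility as ℕD using () renaming (_∣_ to _∣ℕ_)
open import Data.Nat.DivMod using (m*[n/m]≡n; m≡m%n+[m/n]*n; m%n<n)
open import Data.Nat.Primality using (composite; euclidsLemma; prime⇒nonZero; prime⇒nonTrivial)
import Data.Nat.Coprimality as Coprimality
open ℤ using (ℤ; +_; -_; _+_; _-_; _*_; ∣_∣; -1ℤ)
import Data.Integer.Properties as ℤP
open import Data.Integer.Divisibility.Signed using (_∣_; divides; ∣m∣n⇒∣m+n; ∣m⇒∣-m; ∣n⇒∣m*n; ∣m⇒∣m*n; ∣ᵤ⇒∣; ∣⇒∣ᵤ)
open import Data.Integer.GCD using () renaming (gcd to gcdℤ)
open import Data.Integer.Tactic.RingSolver using (solve-∀)
open import Data.Nat.Tactic.RingSolver using () renaming (solve-∀ to ℕ-solve-∀)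
open import Data.Rational using (mkℚ; ↥_; ↧_; ↧ₙ_) renaming (_/_ to _/ℚ_; _+_ to _+ℚ_; _-_ to _-ℚ_; -_ to -ℚ_)
import Data.Rational.Properties as ℚP
open import Data.List using (List; []; _∷_; _++_; length)
open import Data.Product using (_,_; proj₁; proj₂; ∃-syntax)
open import Data.Sum using (_⊎_; inj₁; inj₂)
open import Data.Empty using (⊥-elim)
open import Relation.Nullary using (¬_)
open import Level using (0ℓ)
open import Relation.Binary.Bundles using (Setoid)
open import Relation.Binary.Structures using (IsEquivalence)
open import Relation.Binary.PropositionalEquality using (refl; sym; trans; cong; cong₂; subst; subst₂; _≗_; module ≡-Reasoning)
import Relation.Binary.Reasoning.Setoid as SetoidReasoning

infix 4 _≡_mod_
record _≡_mod_ (a b m : ℤ) : Set where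
  constructor mod-by
  field divides-difference : m ∣ a - b

module _ {m : ℤ} where

  mod-reflexive : ∀ {a b} → a ≡ b → a ≡ b mod m
  mod-reflexive {a} refl = mod-by (divides (+ 0) (trans (ℤP.+-inverseʳ a) (sym (ℤP.*-zeroˡ m))))

  mod-refl : ∀ {a} → a ≡ a mod m
  mod-refl = mod-reflexive refl

  mod-sym : ∀ {a b} → a ≡ b mod m → b ≡ a mod m
  mod-sym {a} {b} (mod-by m∣a-b) = mod-by (subst (m ∣_) (swap a b) (∣m⇒∣-m m∣a-b))
    where
    swap : ∀ a b → - (a - b) ≡ b - a
    swap = solve-∀

  mod-trans : ∀ {a b c} → a ≡ b mod m → b ≡ c mod m → a ≡ c mod m
  mod-trans {a} {b} {c} (mod-by m∣a-b) (mod-by m∣b-c) = mod-by (subst (m ∣_) (telescope a b c) (∣m∣n⇒∣m+n m∣a-b m∣b-c))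
    where
    telescope : ∀ a b c → (a - b) + (b - c) ≡ a - c
    telescope = solve-∀

  +-mod-cong : ∀ {a b c d} → a ≡ b mod m → c ≡ d mod m → a + c ≡ b + d mod m
  +-mod-cong {a} {b} {c} {d} (mod-by m∣a-b) (mod-by m∣c-d) = mod-by (subst (m ∣_) (regroup a b c d) (∣m∣n⇒∣m+n m∣a-b m∣c-d))
    where
    regroup : ∀ a b c d → (a - b) + (c - d) ≡ (a + c) - (b + d)
    regroup = solve-∀

  *-mod-cong : ∀ {a b c d} → a ≡ b mod m → c ≡ d mod m → a * c ≡ b * d mod m
  *-mod-cong {a} {b} {c} {d} (mod-by m∣a-b) (mod-by m∣c-d) =
    mod-by (subst (m ∣_) (regroup a b c d) (∣m∣n⇒∣m+n (∣m⇒∣m*n c m∣a-b) (∣n⇒∣m*n b m∣c-d)))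
    where
    regroup : ∀ a b c d → (a - b) * c + b * (c - d) ≡ a * c - b * d
    regroup = solve-∀

  +-mod-congˡ : ∀ c {a b} → a ≡ b mod m → c + a ≡ c + b mod m
  +-mod-congˡ c = +-mod-cong (mod-refl {c})

  +-mod-congʳ : ∀ c {a b} → a ≡ b mod m → a + c ≡ b + c mod m
  +-mod-congʳ c a≡b = +-mod-cong a≡b (mod-refl {c})

  *-mod-congˡ : ∀ c {a b} → a ≡ b mod m → c * a ≡ c * b mod m
  *-mod-congˡ c = *-mod-cong (mod-refl {c})

  *-mod-congʳ : ∀ c {a b} → a ≡ b mod m → a * c ≡ b * c mod m
  *-mod-congʳ c a≡b = *-mod-cong a≡b (mod-refl {c})

  neg-mod-cong : ∀ {a b} → a ≡ b mod m → - a ≡ - b mod m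
  neg-mod-cong {a} {b} a≡b = subst₂ (λ x y → x ≡ y mod m) (ℤP.-1*i≡-i a) (ℤP.-1*i≡-i b) (*-mod-congˡ -1ℤ a≡b)

  multiple≡0 : ∀ k → k * m ≡ + 0 mod m
  multiple≡0 k = mod-by (divides k (ℤP.+-identityʳ (k * m)))

mod-isEquivalence : ∀ m → IsEquivalence (_≡_mod m)
mod-isEquivalence m = record { refl = mod-refl ; sym = mod-sym ; trans = mod-trans }

mod-setoid : ℤ → Setoid 0ℓ 0ℓ
mod-setoid m = record { isEquivalence = mod-isEquivalence m }

module ≡-mod-Reasoning (m : ℤ) = SetoidReasoning (mod-setoid m)

*-zeroˡ-mod : ∀ b {a m} → a ≡ + 0 mod m → a * b ≡ + 0 mod m
*-zeroˡ-mod b a≡0 = mod-trans (*-mod-congʳ b a≡0) (mod-reflexive (ℤP.*-zeroˡ b))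

*-zeroʳ-mod : ∀ c {a m} → a ≡ + 0 mod m → c * a ≡ + 0 mod m
*-zeroʳ-mod c a≡0 = mod-trans (*-mod-congˡ c a≡0) (mod-reflexive (ℤP.*-zeroʳ c))

*-mod-scale : ∀ c {a b m} → a ≡ b mod m → c * a ≡ c * b mod (c * m)
*-mod-scale c {a} {b} {m} (mod-by (divides k a-b≡k*m)) = mod-by (divides k (begin
  c * a - c * b   ≡⟨ factor c a b ⟩
  c * (a - b)     ≡⟨ cong (c *_) a-b≡k*m ⟩
  c * (k * m)     ≡⟨ swap c k m ⟩
  k * (c * m)     ∎))
  where
  open ≡-Reasoning
  factor : ∀ c a b → c * a - c * b ≡ c * (a - b)
  factor = solve-∀
  swap : ∀ c k m → c * (k * m) ≡ k * (c * m)
  swap = solve-∀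

∑< : ℕ → (ℕ → ℤ) → ℤ
∑< zero f = + 0
∑< (suc n) f = ∑< n f + f n

infixl 10 ∑<
syntax ∑< n (λ i → e) = ∑[ i < n ] e

∑-cong : ∀ n {f g : ℕ → ℤ} → (∀ i → i < n → f i ≡ g i) → ∑< n f ≡ ∑< n g
∑-cong zero f≡g = refl
∑-cong (suc n) f≡g = cong₂ _+_ (∑-cong n (λ i i<n → f≡g i (ℕP.m<n⇒m<1+n i<n))) (f≡g n ℕP.≤-refl)

∑-cong-mod : ∀ {m} n {f g : ℕ → ℤ} → (∀ i → i < n → f i ≡ g i mod m) → ∑< n f ≡ ∑< n g mod m
∑-cong-mod zero f≡g = mod-refl
∑-cong-mod (suc n) f≡g = +-mod-cong (∑-cong-mod n (λ i i<n → f≡g i (ℕP.m<n⇒m<1+n i<n))) (f≡g n ℕP.≤-refl)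

∑-zero : ∀ n {f : ℕ → ℤ} → (∀ i → i < n → f i ≡ + 0) → ∑< n f ≡ + 0
∑-zero n f≡0 = trans (∑-cong n f≡0) (zeros n)
  where
  zeros : ∀ n → ∑[ i < n ] (+ 0) ≡ + 0
  zeros zero = refl
  zeros (suc n) = trans (ℤP.+-identityʳ _) (zeros n)

∑-distrib-+ : ∀ n (f g : ℕ → ℤ) → ∑[ i < n ] (f i + g i) ≡ ∑< n f + ∑< n g
∑-distrib-+ zero f g = refl
∑-distrib-+ (suc n) f g = trans (cong (_+ (f n + g n)) (∑-distrib-+ n f g)) (interchange (∑< n f) (∑< n g) (f n) (g n))
  where
  interchange : ∀ a b c d → a + b + (c + d) ≡ a + c + (b + d)
  interchange = solve-∀

*-distribˡ-∑ : ∀ n c (f : ℕ → ℤ) → ∑[ i < n ] (c * f i) ≡ c * ∑< n f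
*-distribˡ-∑ zero c f = sym (ℤP.*-zeroʳ c)
*-distribˡ-∑ (suc n) c f = trans (cong (_+ c * f n) (*-distribˡ-∑ n c f)) (sym (ℤP.*-distribˡ-+ c (∑< n f) (f n)))

∑-head : ∀ n (f : ℕ → ℤ) → ∑< (suc n) f ≡ f 0 + ∑[ i < n ] f (suc i)
∑-head zero f = ℤP.+-comm (+ 0) (f 0)
∑-head (suc n) f = trans (cong (_+ f (suc n)) (∑-head n f)) (ℤP.+-assoc (f 0) _ _)

∑-split : ∀ a b (f : ℕ → ℤ) → ∑< (a ℕ.+ b) f ≡ ∑< a f + ∑[ i < b ] f (a ℕ.+ i)
∑-split a zero f rewrite ℕP.+-identityʳ a = sym (ℤP.+-identityʳ _)
∑-split a (suc b) f rewrite ℕP.+-suc a b =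
  trans (cong (_+ f (a ℕ.+ b)) (∑-split a b f)) (ℤP.+-assoc (∑< a f) _ _)

∑-comm : ∀ n m (g : ℕ → ℕ → ℤ) → ∑[ i < n ] (∑[ j < m ] g i j) ≡ ∑[ j < m ] (∑[ i < n ] g i j)
∑-comm zero m g = sym (∑-zero m (λ _ _ → refl))
∑-comm (suc n) m g = trans (cong (_+ ∑< m (g n)) (∑-comm n m g)) (sym (∑-distrib-+ m (λ j → ∑[ i < n ] g i j) (g n)))

∑-vanishing-tail : ∀ a b (f : ℕ → ℤ) → (∀ i → f (a ℕ.+ i) ≡ + 0) → ∑< (a ℕ.+ b) f ≡ ∑< a f
∑-vanishing-tail a b f tail≡0 =
  trans (∑-split a b f) (trans (cong (_+_ (∑< a f)) (∑-zero b (λ i _ → tail≡0 i))) (ℤP.+-identityʳ _))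

∑≡0-mod : ∀ {m} n {f : ℕ → ℤ} → (∀ i → i < n → f i ≡ + 0 mod m) → ∑< n f ≡ + 0 mod m
∑≡0-mod n f≡0 = mod-trans (∑-cong-mod n f≡0) (mod-reflexive (∑-zero n (λ _ _ → refl)))

C-pascal : ∀ n k → suc n C suc k ≡ n C k ℕ.+ n C suc k
C-pascal n k = sym (nCk+nC[k+1]≡[n+1]C[k+1] n k)

C-absorb : ∀ n k → suc k ℕ.* (suc n C suc k) ≡ suc n ℕ.* (n C k)
C-absorb n zero = trans (ℕP.*-identityˡ _) (trans (nC1≡n (suc n)) (sym (ℕP.*-identityʳ (suc n))))
C-absorb zero (suc k) = trans (cong (suc (suc k) ℕ.*_) (k>n⇒nCk≡0 {1} (s≤s (s≤s (z≤n {k}))))) (ℕP.*-zeroʳ (suc (suc k)))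
C-absorb (suc n) (suc k) = begin
  suc (suc k) ℕ.* (suc (suc n) C suc (suc k))
    ≡⟨ cong (suc (suc k) ℕ.*_) (C-pascal (suc n) (suc k)) ⟩
  suc (suc k) ℕ.* (suc n C suc k ℕ.+ suc n C suc (suc k))
    ≡⟨ ℕP.*-distribˡ-+ (suc (suc k)) (suc n C suc k) _ ⟩
  suc (suc k) ℕ.* (suc n C suc k) ℕ.+ suc (suc k) ℕ.* (suc n C suc (suc k))
    ≡⟨ cong₂ (λ a b → a ℕ.+ b) (cong (suc n C suc k ℕ.+_) (C-absorb n k)) (C-absorb n (suc k)) ⟩
  suc n C suc k ℕ.+ suc n ℕ.* (n C k) ℕ.+ suc n ℕ.* (n C suc k)
    ≡⟨ cong (λ c → c ℕ.+ suc n ℕ.* (n C k) ℕ.+ suc n ℕ.* (n C suc k)) (C-pascal n k) ⟩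
  n C k ℕ.+ n C suc k ℕ.+ suc n ℕ.* (n C k) ℕ.+ suc n ℕ.* (n C suc k)
    ≡⟨ collect (n C k) (n C suc k) n ⟩
  suc (suc n) ℕ.* (n C k ℕ.+ n C suc k)
    ≡⟨ cong (suc (suc n) ℕ.*_) (C-pascal n k) ⟨
  suc (suc n) ℕ.* (suc n C suc k) ∎
  where
  open ≡-Reasoning
  collect : ∀ a b n → a ℕ.+ b ℕ.+ suc n ℕ.* a ℕ.+ suc n ℕ.* b ≡ suc (suc n) ℕ.* (a ℕ.+ b)
  collect = ℕ-solve-∀

infix 11 _Cℤ_
_Cℤ_ : ℕ → ℕ → ℤ
n Cℤ k = + (n C k)

C-pascal-ℤ : ∀ n k → suc n Cℤ suc k ≡ n Cℤ k + n Cℤ suc k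
C-pascal-ℤ n k = trans (cong +_ (C-pascal n k)) (ℤP.pos-+ (n C k) (n C suc k))

C-hockey-stick : ∀ m j → ∑[ k < m ] k Cℤ j ≡ m Cℤ suc j
C-hockey-stick zero j = refl
C-hockey-stick (suc m) j =
  trans (cong (_+ m Cℤ j) (C-hockey-stick m j)) (trans (ℤP.+-comm (m Cℤ suc j) (m Cℤ j)) (sym (C-pascal-ℤ m j)))

∑-pascal : ∀ k (A : ℕ → ℤ) →
  ∑[ j < suc (suc k) ] (suc k Cℤ j * A j) ≡ ∑[ j < suc k ] (k Cℤ j * A j) + ∑[ j < suc k ] (k Cℤ j * A (suc j))
∑-pascal k A = begin
  ∑[ j < suc (suc k) ] (suc k Cℤ j * A j)
    ≡⟨ ∑-head (suc k) _ ⟩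
  A₀ + ∑[ j < suc k ] (suc k Cℤ suc j * A (suc j))
    ≡⟨ cong (_+_ A₀) (∑-cong (suc k) (λ j _ → split j)) ⟩
  A₀ + ∑[ j < suc k ] (k Cℤ j * A (suc j) + k Cℤ suc j * A (suc j))
    ≡⟨ cong (_+_ A₀) (∑-distrib-+ (suc k) _ _) ⟩
  A₀ + (Y + (X + k Cℤ suc k * A (suc k)))
    ≡⟨ cong (λ c → A₀ + (Y + (X + + c * A (suc k)))) (k>n⇒nCk≡0 (ℕP.n<1+n k)) ⟩
  A₀ + (Y + (X + + 0 * A (suc k)))
    ≡⟨ regroup A₀ X Y (A (suc k)) ⟩
  (A₀ + X) + Y
    ≡⟨ cong (_+ Y) (∑-head k (λ j → k Cℤ j * A j)) ⟨
  ∑[ j < suc k ] (k Cℤ j * A j) + Y ∎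
  where
  open ≡-Reasoning
  A₀ : ℤ
  A₀ = + 1 * A 0
  X : ℤ
  X = ∑[ j < k ] (k Cℤ suc j * A (suc j))
  Y : ℤ
  Y = ∑[ j < suc k ] (k Cℤ j * A (suc j))
  split : ∀ j → suc k Cℤ suc j * A (suc j) ≡ k Cℤ j * A (suc j) + k Cℤ suc j * A (suc j)
  split j = trans (cong (_* A (suc j)) (C-pascal-ℤ k j)) (ℤP.*-distribʳ-+ (A (suc j)) (k Cℤ j) (k Cℤ suc j))
  regroup : ∀ a x y b → a + (y + (x + + 0 * b)) ≡ (a + x) + y
  regroup = solve-∀

binomial-theorem : ∀ m a b → (a + b) ℤ.^ m ≡ ∑[ i < suc m ] (m Cℤ i * (a ℤ.^ i * b ℤ.^ (m ℕ.∸ i)))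
binomial-theorem zero a b = refl
binomial-theorem (suc m) a b = sym (begin
  ∑[ i < suc (suc m) ] (suc m Cℤ i * A i)
    ≡⟨ ∑-pascal m A ⟩
  ∑[ i < suc m ] (m Cℤ i * A i) + ∑[ i < suc m ] (m Cℤ i * A (suc i))
    ≡⟨ cong₂ _+_ (∑-cong (suc m) (λ i i<1+m → pull-b i (ℕP.≤-pred i<1+m))) (∑-cong (suc m) (λ i _ → pull-a i)) ⟩
  ∑[ i < suc m ] (b * t i) + ∑[ i < suc m ] (a * t i)
    ≡⟨ cong₂ _+_ (*-distribˡ-∑ (suc m) b t) (*-distribˡ-∑ (suc m) a t) ⟩
  b * ∑< (suc m) t + a * ∑< (suc m) t
    ≡⟨ cong (λ s → b * s + a * s) (binomial-theorem m a b) ⟨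
  b * (a + b) ℤ.^ m + a * (a + b) ℤ.^ m
    ≡⟨ factor a b ((a + b) ℤ.^ m) ⟩
  (a + b) ℤ.^ suc m ∎)
  where
  open ≡-Reasoning
  A : ℕ → ℤ
  A i = a ℤ.^ i * b ℤ.^ (suc m ℕ.∸ i)
  t : ℕ → ℤ
  t i = m Cℤ i * (a ℤ.^ i * b ℤ.^ (m ℕ.∸ i))
  pull-b : ∀ i → i ≤ m → m Cℤ i * A i ≡ b * t i
  pull-b i i≤m rewrite ℕP.+-∸-assoc 1 i≤m = shuffle (m Cℤ i) (a ℤ.^ i) b (b ℤ.^ (m ℕ.∸ i))
    where
    shuffle : ∀ c x b y → c * (x * (b * y)) ≡ b * (c * (x * y))
    shuffle = solve-∀
  pull-a : ∀ i → m Cℤ i * A (suc i) ≡ a * t i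
  pull-a i = shuffle (m Cℤ i) a (a ℤ.^ i) (b ℤ.^ (m ℕ.∸ i))
    where
    shuffle : ∀ c a x y → c * ((a * x) * y) ≡ a * (c * (x * y))
    shuffle = solve-∀
  factor : ∀ a b z → b * z + a * z ≡ (a + b) * z
  factor = solve-∀

C-suc-ratio : ∀ m k → + suc k * m Cℤ suc k ≡ (+ m - + k) * m Cℤ k
C-suc-ratio m k = begin
  + suc k * m Cℤ suc k
    ≡⟨ isolate (+ suc k) (m Cℤ k) (m Cℤ suc k) ⟩
  + suc k * (m Cℤ k + m Cℤ suc k) - + suc k * m Cℤ k
    ≡⟨ cong (λ c → + suc k * c - + suc k * m Cℤ k) (C-pascal-ℤ m k) ⟨
  + suc k * suc m Cℤ suc k - + suc k * m Cℤ k
    ≡⟨ cong (_- + suc k * m Cℤ k) (trans (sym (ℤP.pos-* (suc k) _)) (trans (cong +_ (C-absorb m k)) (ℤP.pos-* (suc m) _))) ⟩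
  + suc m * m Cℤ k - + suc k * m Cℤ k
    ≡⟨ difference m k (m Cℤ k) ⟩
  (+ m - + k) * m Cℤ k ∎
  where
  open ≡-Reasoning
  isolate : ∀ a x y → a * y ≡ a * (x + y) - a * x
  isolate = solve-∀
  difference : ∀ m k c → + suc m * c - + suc k * c ≡ (+ m - + k) * c
  difference m k c = trans (cong₂ (λ a b → a * c - b * c) (ℤP.pos-+ 1 m) (ℤP.pos-+ 1 k)) (collect (+ m) (+ k) c)
    where
    collect : ∀ m k c → (+ 1 + m) * c - (+ 1 + k) * c ≡ (m - k) * c
    collect = solve-∀

sign : ℕ → ℤ
sign j = -1ℤ ℤ.^ j

sign-square : ∀ j → sign j * sign j ≡ + 1
sign-square zero = refl
sign-square (suc j) = trans (negate-twice (sign j)) (sign-square j)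
  where
  negate-twice : ∀ s → (-1ℤ * s) * (-1ℤ * s) ≡ s * s
  negate-twice = solve-∀

sign-even : ∀ j → sign (j ℕ.+ j) ≡ + 1
sign-even j = trans (ℤP.^-distribˡ-+-* -1ℤ j j) (sign-square j)

^-distribʳ-* : ∀ a b k → (a * b) ℤ.^ k ≡ a ℤ.^ k * b ℤ.^ k
^-distribʳ-* a b zero = refl
^-distribʳ-* a b (suc k) = trans (cong (a * b *_) (^-distribʳ-* a b k)) (interchange a b (a ℤ.^ k) (b ℤ.^ k))
  where
  interchange : ∀ a b x y → a * b * (x * y) ≡ a * x * (b * y)
  interchange = solve-∀

-- Coefficient sequences of power series: shift, diff and trinomial multiply by x, 1 - x and 1 + x + x².
Series : Set
Series = ℕ → ℤ

unit : Series
unit zero = + 1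
unit (suc i) = + 0

shift : Series → Series
shift f zero = + 0
shift f (suc i) = f i

shift^ : ℕ → Series → Series
shift^ zero f = f
shift^ (suc a) f = shift (shift^ a f)

diff : Series → Series
diff f i = f i - shift f i

diff^ : ℕ → Series → Series
diff^ zero f = f
diff^ (suc m) f = diff (diff^ m f)

trinomial : Series → Series
trinomial f i = shift (shift f) i + shift f i + f i

trinomial^ : ℕ → Series → Series
trinomial^ zero f = f
trinomial^ (suc k) f = trinomial (trinomial^ k f)

shift-cong : ∀ {f g} → f ≗ g → shift f ≗ shift g
shift-cong f≗g zero = refl
shift-cong f≗g (suc i) = f≗g i

shift^-cong : ∀ a {f g} → f ≗ g → shift^ a f ≗ shift^ a g
shift^-cong zero f≗g = f≗g
shift^-cong (suc a) f≗g = shift-cong (shift^-cong a f≗g)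

diff-cong : ∀ {f g} → f ≗ g → diff f ≗ diff g
diff-cong f≗g i = cong₂ _-_ (f≗g i) (shift-cong f≗g i)

trinomial-cong : ∀ {f g} → f ≗ g → trinomial f ≗ trinomial g
trinomial-cong f≗g i = cong₂ _+_ (cong₂ _+_ (shift-cong (shift-cong f≗g) i) (shift-cong f≗g i)) (f≗g i)

shift^-+ : ∀ a g i → shift^ a g (a ℕ.+ i) ≡ g i
shift^-+ zero g i = refl
shift^-+ (suc a) g i = shift^-+ a g i

diff-shift : ∀ f → diff (shift f) ≗ shift (diff f)
diff-shift f zero = refl
diff-shift f (suc i) = refl

diff-shift^ : ∀ a f → diff (shift^ a f) ≗ shift^ a (diff f)
diff-shift^ zero f i = refl
diff-shift^ (suc a) f i = trans (diff-shift (shift^ a f) i) (shift-cong (diff-shift^ a f) i)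

-- 1 + x + x² = 3x + (1 - x)²
trinomial-decomposition : ∀ f i → trinomial f i ≡ + 3 * shift f i + diff (diff f) i
trinomial-decomposition f zero = expand (f 0)
  where
  expand : ∀ a → + 0 + + 0 + a ≡ + 3 * + 0 + ((a - + 0) - + 0)
  expand = solve-∀
trinomial-decomposition f (suc i) = expand (shift f i) (f i) (f (suc i))
  where
  expand : ∀ a b c → a + b + c ≡ + 3 * b + ((c - b) - (b - a))
  expand = solve-∀

diff^-unit : ∀ m i → diff^ m unit i ≡ sign i * m Cℤ i
diff^-unit zero zero = refl
diff^-unit zero (suc i) = sym (ℤP.*-zeroʳ (sign (suc i)))
diff^-unit (suc m) zero = cong (_- + 0) (diff^-unit m zero)
diff^-unit (suc m) (suc i) = begin
  diff^ m unit (suc i) - diff^ m unit i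
    ≡⟨ cong₂ _-_ (diff^-unit m (suc i)) (diff^-unit m i) ⟩
  (-1ℤ * sign i) * m Cℤ suc i - sign i * m Cℤ i
    ≡⟨ collect (sign i) (m Cℤ i) (m Cℤ suc i) ⟩
  (-1ℤ * sign i) * (m Cℤ i + m Cℤ suc i)
    ≡⟨ cong ((-1ℤ * sign i) *_) (C-pascal-ℤ m i) ⟨
  sign (suc i) * suc m Cℤ suc i ∎
  where
  open ≡-Reasoning
  collect : ∀ s a b → (-1ℤ * s) * b - s * a ≡ (-1ℤ * s) * (a + b)
  collect = solve-∀

shift-∑ : ∀ n (c : ℕ → ℤ) (h : ℕ → Series) →
  shift (λ i → ∑[ j < n ] (c j * h j i)) ≗ (λ i → ∑[ j < n ] (c j * shift (h j) i))
shift-∑ n c h zero = sym (∑-zero n (λ j _ → ℤP.*-zeroʳ (c j)))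
shift-∑ n c h (suc i) = refl

trinomial-∑ : ∀ n (c : ℕ → ℤ) (h : ℕ → Series) →
  trinomial (λ i → ∑[ j < n ] (c j * h j i)) ≗ (λ i → ∑[ j < n ] (c j * trinomial (h j) i))
trinomial-∑ n c h i = begin
  shift (shift F) i + shift F i + F i
    ≡⟨ cong (λ s → s + shift F i + F i) (trans (shift-cong (shift-∑ n c h) i) (shift-∑ n c (λ j → shift (h j)) i)) ⟩
  ∑[ j < n ] (c j * shift (shift (h j)) i) + shift F i + F i
    ≡⟨ cong (λ s → ∑[ j < n ] (c j * shift (shift (h j)) i) + s + F i) (shift-∑ n c h i) ⟩
  ∑[ j < n ] (c j * shift (shift (h j)) i) + ∑[ j < n ] (c j * shift (h j) i) + F i
    ≡⟨ cong (_+ F i) (∑-distrib-+ n _ _) ⟨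
  ∑[ j < n ] (c j * shift (shift (h j)) i + c j * shift (h j) i) + F i
    ≡⟨ ∑-distrib-+ n _ _ ⟨
  ∑[ j < n ] (c j * shift (shift (h j)) i + c j * shift (h j) i + c j * h j i)
    ≡⟨ ∑-cong n (λ j _ → factor (c j) _ _ _) ⟩
  ∑[ j < n ] (c j * trinomial (h j) i) ∎
  where
  open ≡-Reasoning
  F : Series
  F i = ∑[ j < n ] (c j * h j i)
  factor : ∀ c a b d → c * a + c * b + c * d ≡ c * (a + b + d)
  factor = solve-∀

diff^-double-suc : ∀ j f → diff^ (suc j ℕ.+ suc j) f ≗ diff (diff (diff^ (j ℕ.+ j) f))
diff^-double-suc j f i = cong (λ m → diff^ m f i) (cong suc (ℕP.+-suc j j))

trinomial^-expansion : ∀ k → trinomial^ k unit ≗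
  (λ i → ∑[ j < suc k ] (k Cℤ j * (+ 3) ℤ.^ (k ℕ.∸ j) * shift^ (k ℕ.∸ j) (diff^ (j ℕ.+ j) unit) i))
trinomial^-expansion zero zero = refl
trinomial^-expansion zero (suc i) = refl
trinomial^-expansion (suc k) i = begin
  trinomial (trinomial^ k unit) i
    ≡⟨ trinomial-cong (trinomial^-expansion k) i ⟩
  trinomial (λ i → ∑[ j < suc k ] (c j * H j i)) i
    ≡⟨ trinomial-∑ (suc k) c H i ⟩
  ∑[ j < suc k ] (c j * trinomial (H j) i)
    ≡⟨ ∑-cong (suc k) (λ j j<1+k → split j (ℕP.≤-pred j<1+k)) ⟩
  ∑[ j < suc k ] (k Cℤ j * A j + k Cℤ j * A (suc j))
    ≡⟨ ∑-distrib-+ (suc k) _ _ ⟩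
  ∑[ j < suc k ] (k Cℤ j * A j) + ∑[ j < suc k ] (k Cℤ j * A (suc j))
    ≡⟨ ∑-pascal k A ⟨
  ∑[ j < suc (suc k) ] (suc k Cℤ j * A j)
    ≡⟨ ∑-cong (suc (suc k)) (λ j _ → sym (ℤP.*-assoc (suc k Cℤ j) _ _)) ⟩
  ∑[ j < suc (suc k) ] (suc k Cℤ j * (+ 3) ℤ.^ (suc k ℕ.∸ j) * shift^ (suc k ℕ.∸ j) (diff^ (j ℕ.+ j) unit) i) ∎
  where
  open ≡-Reasoning
  c : ℕ → ℤ
  c j = k Cℤ j * (+ 3) ℤ.^ (k ℕ.∸ j)
  H : ℕ → Series
  H j = shift^ (k ℕ.∸ j) (diff^ (j ℕ.+ j) unit)
  A : ℕ → ℤ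
  A j = (+ 3) ℤ.^ (suc k ℕ.∸ j) * shift^ (suc k ℕ.∸ j) (diff^ (j ℕ.+ j) unit) i
  distribute : ∀ b t x y → (b * t) * (+ 3 * x + y) ≡ b * ((+ 3 * t) * x) + b * (t * y)
  distribute = solve-∀
  diff²-H : ∀ j → diff (diff (H j)) i ≡ shift^ (k ℕ.∸ j) (diff^ (suc j ℕ.+ suc j) unit) i
  diff²-H j = begin
    diff (diff (H j)) i
      ≡⟨ diff-cong (diff-shift^ (k ℕ.∸ j) _) i ⟩
    diff (shift^ (k ℕ.∸ j) (diff (diff^ (j ℕ.+ j) unit))) i
      ≡⟨ diff-shift^ (k ℕ.∸ j) _ i ⟩
    shift^ (k ℕ.∸ j) (diff (diff (diff^ (j ℕ.+ j) unit))) i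
      ≡⟨ shift^-cong (k ℕ.∸ j) (diff^-double-suc j unit) i ⟨
    shift^ (k ℕ.∸ j) (diff^ (suc j ℕ.+ suc j) unit) i ∎
  split : ∀ j → j ≤ k → c j * trinomial (H j) i ≡ k Cℤ j * A j + k Cℤ j * A (suc j)
  split j j≤k = begin
    c j * trinomial (H j) i
      ≡⟨ cong (c j *_) (trinomial-decomposition (H j) i) ⟩
    c j * (+ 3 * shift (H j) i + diff (diff (H j)) i)
      ≡⟨ cong (λ d → c j * (+ 3 * shift (H j) i + d)) (diff²-H j) ⟩
    c j * (+ 3 * shift (H j) i + shift^ (k ℕ.∸ j) (diff^ (suc j ℕ.+ suc j) unit) i)
      ≡⟨ distribute (k Cℤ j) ((+ 3) ℤ.^ (k ℕ.∸ j)) _ _ ⟩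
    k Cℤ j * ((+ 3) ℤ.^ suc (k ℕ.∸ j) * shift^ (suc (k ℕ.∸ j)) (diff^ (j ℕ.+ j) unit) i) + k Cℤ j * A (suc j)
      ≡⟨ cong (λ e → k Cℤ j * ((+ 3) ℤ.^ e * shift^ e (diff^ (j ℕ.+ j) unit) i) + k Cℤ j * A (suc j)) (ℕP.+-∸-assoc 1 j≤k) ⟨
    k Cℤ j * A j + k Cℤ j * A (suc j) ∎

-- The padding function in the where-block of mulTri cannot be referred to by name;
-- the metavariable padding is solved by it (abstracting x ∷ xs makes the constraint a pattern).
mutual
  padding : List ℕ → List ℕ → List ℕ
  padding = _

  mulTri-∷ : ∀ x xs → mulTri (x ∷ xs) ≡
    x ∷ add3 (0 ∷ x ∷ xs) (x ∷ padding (x ∷ xs) xs) (padding (x ∷ xs) (padding (x ∷ xs) xs))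
  mulTri-∷ x xs with x ∷ xs
  ... | cs = refl

padding-append : ∀ cs ys → padding cs ys ≡ ys ++ 0 ∷ []
padding-append cs [] = refl
padding-append cs (y ∷ ys) = cong (y ∷_) (padding-append cs ys)

nth-append-0 : ∀ xs i → nth (xs ++ 0 ∷ []) i ≡ nth xs i
nth-append-0 [] zero = refl
nth-append-0 [] (suc i) = refl
nth-append-0 (x ∷ xs) zero = refl
nth-append-0 (x ∷ xs) (suc i) = nth-append-0 xs i

length-append-0 : ∀ xs → length (xs ++ 0 ∷ []) ≡ suc (length xs)
length-append-0 [] = refl
length-append-0 (x ∷ xs) = cong suc (length-append-0 xs)

nth-add3 : ∀ as bs cs → length as ≡ length bs → length bs ≡ length cs → ∀ i →
  nth (add3 as bs cs) i ≡ nth as i ℕ.+ nth bs i ℕ.+ nth cs i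
nth-add3 [] [] [] _ _ i = refl
nth-add3 (a ∷ as) (b ∷ bs) (c ∷ cs) _ _ zero = refl
nth-add3 (a ∷ as) (b ∷ bs) (c ∷ cs) |as|≡|bs| |bs|≡|cs| (suc i) =
  nth-add3 as bs cs (ℕP.suc-injective |as|≡|bs|) (ℕP.suc-injective |bs|≡|cs|) i
nth-add3 [] (b ∷ bs) _ () _ _
nth-add3 (a ∷ as) [] _ () _ _
nth-add3 [] [] (c ∷ cs) _ () _
nth-add3 (a ∷ as) (b ∷ bs) [] _ () _

nth-mulTri : ∀ cs i → nth (mulTri cs) i ≡ nth (0 ∷ 0 ∷ cs) i ℕ.+ nth (0 ∷ cs) i ℕ.+ nth cs i
nth-mulTri [] zero = refl
nth-mulTri [] (suc zero) = refl
nth-mulTri [] (suc (suc i)) = refl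
nth-mulTri (x ∷ xs) zero rewrite mulTri-∷ x xs = refl
nth-mulTri (x ∷ xs) (suc i) rewrite mulTri-∷ x xs | padding-append (x ∷ xs) xs | padding-append (x ∷ xs) (xs ++ 0 ∷ []) =
  trans (nth-add3 (0 ∷ x ∷ xs) (x ∷ xs ++ 0 ∷ []) ((xs ++ 0 ∷ []) ++ 0 ∷ [])
                  (cong suc (sym (length-append-0 xs))) (sym (length-append-0 (xs ++ 0 ∷ []))) i)
        (cong₂ (λ b c → nth (0 ∷ x ∷ xs) i ℕ.+ b ℕ.+ c)
               (nth-append-0 (x ∷ xs) i) (trans (nth-append-0 (xs ++ 0 ∷ []) i) (nth-append-0 xs i)))

coefficients : List ℕ → Series
coefficients cs i = + nth cs i

coefficients-∷0 : ∀ cs → coefficients (0 ∷ cs) ≗ shift (coefficients cs)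
coefficients-∷0 cs zero = refl
coefficients-∷0 cs (suc i) = refl

-- Read with exponents shifted by k, triPow k lists the coefficients of (1 + x + x²)ᵏ.
triPow-coefficients : ∀ k → coefficients (triPow k) ≗ trinomial^ k unit
triPow-coefficients zero zero = refl
triPow-coefficients zero (suc zero) = refl
triPow-coefficients zero (suc (suc i)) = refl
triPow-coefficients (suc k) i = begin
  + nth (mulTri cs) i
    ≡⟨ cong +_ (nth-mulTri cs i) ⟩
  + (nth (0 ∷ 0 ∷ cs) i ℕ.+ nth (0 ∷ cs) i ℕ.+ nth cs i)
    ≡⟨ trans (ℤP.pos-+ _ (nth cs i)) (cong (_+ + nth cs i) (ℤP.pos-+ (nth (0 ∷ 0 ∷ cs) i) _)) ⟩
  + nth (0 ∷ 0 ∷ cs) i + + nth (0 ∷ cs) i + + nth cs i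
    ≡⟨ cong₂ (λ a b → a + b + + nth cs i)
         (trans (coefficients-∷0 (0 ∷ cs) i) (shift-cong (coefficients-∷0 cs) i)) (coefficients-∷0 cs i) ⟩
  trinomial (coefficients cs) i
    ≡⟨ trinomial-cong (triPow-coefficients k) i ⟩
  trinomial^ (suc k) unit i ∎
  where
  open ≡-Reasoning
  cs : List ℕ
  cs = triPow k

central : ℕ → ℤ
central j = (j ℕ.+ j) Cℤ j

T-closed-form : ∀ k → + T k ≡ ∑[ j < suc k ] (k Cℤ j * (+ 3) ℤ.^ (k ℕ.∸ j) * (sign j * central j))
T-closed-form k = begin
  + T k
    ≡⟨ triPow-coefficients k k ⟩
  trinomial^ k unit k
    ≡⟨ trinomial^-expansion k k ⟩
  ∑[ j < suc k ] (k Cℤ j * (+ 3) ℤ.^ (k ℕ.∸ j) * shift^ (k ℕ.∸ j) (diff^ (j ℕ.+ j) unit) k)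
    ≡⟨ ∑-cong (suc k) (λ j j<1+k → cong (k Cℤ j * (+ 3) ℤ.^ (k ℕ.∸ j) *_) (middle-coefficient j (ℕP.≤-pred j<1+k))) ⟩
  ∑[ j < suc k ] (k Cℤ j * (+ 3) ℤ.^ (k ℕ.∸ j) * (sign j * central j)) ∎
  where
  open ≡-Reasoning
  middle-coefficient : ∀ j → j ≤ k → shift^ (k ℕ.∸ j) (diff^ (j ℕ.+ j) unit) k ≡ sign j * central j
  middle-coefficient j j≤k = begin
    shift^ (k ℕ.∸ j) (diff^ (j ℕ.+ j) unit) k
      ≡⟨ cong (shift^ (k ℕ.∸ j) (diff^ (j ℕ.+ j) unit)) (ℕP.m∸n+n≡m j≤k) ⟨
    shift^ (k ℕ.∸ j) (diff^ (j ℕ.+ j) unit) (k ℕ.∸ j ℕ.+ j)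
      ≡⟨ shift^-+ (k ℕ.∸ j) _ j ⟩
    diff^ (j ℕ.+ j) unit j
      ≡⟨ diff^-unit (j ℕ.+ j) j ⟩
    sign j * central j ∎

central-suc : ∀ j → + suc j * central (suc j) ≡ + 2 * + suc (j ℕ.+ j) * central j
central-suc j = begin
  + suc j * central (suc j)
    ≡⟨ ℤP.pos-* (suc j) _ ⟨
  + (suc j ℕ.* ((suc j ℕ.+ suc j) C suc j))
    ≡⟨ cong +_ (ℕ-identity j) ⟩
  + (2 ℕ.* suc (j ℕ.+ j) ℕ.* ((j ℕ.+ j) C j))
    ≡⟨ trans (ℤP.pos-* (2 ℕ.* suc (j ℕ.+ j)) _) (cong (_* central j) (ℤP.pos-* 2 (suc (j ℕ.+ j)))) ⟩
  + 2 * + suc (j ℕ.+ j) * central j ∎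
  where
  open ≡-Reasoning
  ℕ-identity : ∀ j → suc j ℕ.* ((suc j ℕ.+ suc j) C suc j) ≡ 2 ℕ.* suc (j ℕ.+ j) ℕ.* ((j ℕ.+ j) C j)
  ℕ-identity j = begin
    suc j ℕ.* ((suc j ℕ.+ suc j) C suc j)
      ≡⟨ cong (λ m → suc j ℕ.* (suc m C suc j)) (ℕP.+-suc j j) ⟩
    suc j ℕ.* (suc (suc (j ℕ.+ j)) C suc j)
      ≡⟨ cong (suc j ℕ.*_) (C-pascal (suc (j ℕ.+ j)) j) ⟩
    suc j ℕ.* (suc (j ℕ.+ j) C j ℕ.+ suc (j ℕ.+ j) C suc j)
      ≡⟨ cong (λ c → suc j ℕ.* (c ℕ.+ suc (j ℕ.+ j) C suc j)) symmetric ⟩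
    suc j ℕ.* (suc (j ℕ.+ j) C suc j ℕ.+ suc (j ℕ.+ j) C suc j)
      ≡⟨ double (suc j) (suc (j ℕ.+ j) C suc j) ⟩
    2 ℕ.* (suc j ℕ.* (suc (j ℕ.+ j) C suc j))
      ≡⟨ cong (2 ℕ.*_) (C-absorb (j ℕ.+ j) j) ⟩
    2 ℕ.* (suc (j ℕ.+ j) ℕ.* ((j ℕ.+ j) C j))
      ≡⟨ ℕP.*-assoc 2 (suc (j ℕ.+ j)) _ ⟨
    2 ℕ.* suc (j ℕ.+ j) ℕ.* ((j ℕ.+ j) C j) ∎
    where
    symmetric : suc (j ℕ.+ j) C j ≡ suc (j ℕ.+ j) C suc j
    symmetric = trans (nCk≡nC[n∸k] (ℕP.≤-trans (ℕP.m≤m+n j j) (ℕP.n≤1+n (j ℕ.+ j))))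
                      (cong (suc (j ℕ.+ j) C_) (trans (ℕP.+-∸-assoc 1 (ℕP.m≤m+n j j)) (cong suc (ℕP.m+n∸m≡n j j))))
    double : ∀ a x → a ℕ.* (x ℕ.+ x) ≡ 2 ℕ.* (a ℕ.* x)
    double = ℕ-solve-∀

-- = 3ᵐ ∑_{k<m} T_k / 3ᵏ
weighted-sum : ℕ → ℤ
weighted-sum m = ∑[ k < m ] (+ T k * (+ 3) ℤ.^ (m ℕ.∸ k))

∸-telescope : ∀ {j k m} → j ≤ k → k ≤ m → (k ℕ.∸ j) ℕ.+ (m ℕ.∸ k) ≡ m ℕ.∸ j
∸-telescope {j} {k} {m} j≤k k≤m = ℕP.+-cancelˡ-≡ j _ _ (begin
  j ℕ.+ ((k ℕ.∸ j) ℕ.+ (m ℕ.∸ k)) ≡⟨ ℕP.+-assoc j (k ℕ.∸ j) (m ℕ.∸ k) ⟨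
  j ℕ.+ (k ℕ.∸ j) ℕ.+ (m ℕ.∸ k)   ≡⟨ cong (ℕ._+ (m ℕ.∸ k)) (ℕP.m+[n∸m]≡n j≤k) ⟩
  k ℕ.+ (m ℕ.∸ k)                 ≡⟨ ℕP.m+[n∸m]≡n k≤m ⟩
  m                               ≡⟨ ℕP.m+[n∸m]≡n (ℕP.≤-trans j≤k k≤m) ⟨
  j ℕ.+ (m ℕ.∸ j)                 ∎)
  where open ≡-Reasoning

weighted-sum-closed-form : ∀ m →
  weighted-sum m ≡ ∑[ j < m ] (m Cℤ suc j * ((+ 3) ℤ.^ (m ℕ.∸ j) * (sign j * central j)))
weighted-sum-closed-form m = begin
  weighted-sum m
    ≡⟨ ∑-cong m (λ k k<m → scaled-T k k<m) ⟩
  ∑[ k < m ] (∑[ j < m ] (k Cℤ j * w j))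
    ≡⟨ ∑-comm m m _ ⟩
  ∑[ j < m ] (∑[ k < m ] (k Cℤ j * w j))
    ≡⟨ ∑-cong m (λ j _ → hockey-stick j) ⟩
  ∑[ j < m ] (m Cℤ suc j * w j) ∎
  where
  open ≡-Reasoning
  w : ℕ → ℤ
  w j = (+ 3) ℤ.^ (m ℕ.∸ j) * (sign j * central j)
  hockey-stick : ∀ j → ∑[ k < m ] (k Cℤ j * w j) ≡ m Cℤ suc j * w j
  hockey-stick j = begin
    ∑[ k < m ] (k Cℤ j * w j)   ≡⟨ ∑-cong m (λ k _ → ℤP.*-comm (k Cℤ j) (w j)) ⟩
    ∑[ k < m ] (w j * k Cℤ j)   ≡⟨ *-distribˡ-∑ m (w j) (λ k → k Cℤ j) ⟩
    w j * ∑[ k < m ] k Cℤ j     ≡⟨ cong (w j *_) (C-hockey-stick m j) ⟩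
    w j * m Cℤ suc j            ≡⟨ ℤP.*-comm (w j) (m Cℤ suc j) ⟩
    m Cℤ suc j * w j            ∎
  scaled-T : ∀ k → k < m → + T k * (+ 3) ℤ.^ (m ℕ.∸ k) ≡ ∑[ j < m ] (k Cℤ j * w j)
  scaled-T k k<m = begin
    + T k * t
      ≡⟨ cong (_* t) (T-closed-form k) ⟩
    ∑[ j < suc k ] (k Cℤ j * (+ 3) ℤ.^ (k ℕ.∸ j) * (sign j * central j)) * t
      ≡⟨ ℤP.*-comm _ t ⟩
    t * ∑[ j < suc k ] (k Cℤ j * (+ 3) ℤ.^ (k ℕ.∸ j) * (sign j * central j))
      ≡⟨ *-distribˡ-∑ (suc k) t _ ⟨
    ∑[ j < suc k ] (t * (k Cℤ j * (+ 3) ℤ.^ (k ℕ.∸ j) * (sign j * central j)))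
      ≡⟨ ∑-cong (suc k) (λ j j<1+k → absorb-power j (ℕP.≤-pred j<1+k)) ⟩
    ∑[ j < suc k ] (k Cℤ j * w j)
      ≡⟨ ∑-vanishing-tail (suc k) (m ℕ.∸ suc k) _ (λ i → cong (λ c → + c * w (suc k ℕ.+ i)) (k>n⇒nCk≡0 (s≤s (ℕP.m≤m+n k i)))) ⟨
    ∑[ j < suc k ℕ.+ (m ℕ.∸ suc k) ] (k Cℤ j * w j)
      ≡⟨ cong (λ n → ∑[ j < n ] (k Cℤ j * w j)) (ℕP.m+[n∸m]≡n k<m) ⟩
    ∑[ j < m ] (k Cℤ j * w j) ∎
    where
    t : ℤ
    t = (+ 3) ℤ.^ (m ℕ.∸ k)
    shuffle : ∀ t c u x → t * ((c * u) * x) ≡ c * ((u * t) * x)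
    shuffle = solve-∀
    absorb-power : ∀ j → j ≤ k → t * (k Cℤ j * (+ 3) ℤ.^ (k ℕ.∸ j) * (sign j * central j)) ≡ k Cℤ j * w j
    absorb-power j j≤k = trans (shuffle t (k Cℤ j) ((+ 3) ℤ.^ (k ℕ.∸ j)) (sign j * central j))
      (cong (λ u → k Cℤ j * (u * (sign j * central j)))
        (trans (sym (ℤP.^-distribˡ-+-* (+ 3) (k ℕ.∸ j) (m ℕ.∸ k))) (cong ((+ 3) ℤ.^_) (∸-telescope j≤k (ℕP.<⇒≤ k<m)))))

weighted-sum-suc : ∀ m → weighted-sum (suc m) ≡ + 3 * (weighted-sum m + + T m)
weighted-sum-suc m = begin
  ∑[ k < m ] (+ T k * (+ 3) ℤ.^ (suc m ℕ.∸ k)) + + T m * (+ 3) ℤ.^ (suc m ℕ.∸ m)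
    ≡⟨ cong₂ _+_ (∑-cong m (λ k k<m → pull-3 k (ℕP.<⇒≤ k<m))) (cong (λ e → + T m * (+ 3) ℤ.^ e) (ℕP.m+n∸n≡m 1 m)) ⟩
  ∑[ k < m ] (+ 3 * (+ T k * (+ 3) ℤ.^ (m ℕ.∸ k))) + + T m * (+ 3 * + 1)
    ≡⟨ cong (_+ + T m * (+ 3 * + 1)) (*-distribˡ-∑ m (+ 3) _) ⟩
  + 3 * weighted-sum m + + T m * (+ 3 * + 1)
    ≡⟨ factor (weighted-sum m) (+ T m) ⟩
  + 3 * (weighted-sum m + + T m) ∎
  where
  open ≡-Reasoning
  pull-3 : ∀ k → k ≤ m → + T k * (+ 3) ℤ.^ (suc m ℕ.∸ k) ≡ + 3 * (+ T k * (+ 3) ℤ.^ (m ℕ.∸ k))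
  pull-3 k k≤m = trans (cong (λ e → + T k * (+ 3) ℤ.^ e) (ℕP.+-∸-assoc 1 k≤m)) (commute (+ T k) ((+ 3) ℤ.^ (m ℕ.∸ k)))
    where
    commute : ∀ t y → t * (+ 3 * y) ≡ + 3 * (t * y)
    commute = solve-∀
  factor : ∀ x t → + 3 * x + t * (+ 3 * + 1) ≡ + 3 * (x + t)
  factor = solve-∀

infix 4 _≃_/_
-- q = a / d, where the fraction a / d need not be in lowest terms.
record _≃_/_ (q : ℚ) (a : ℤ) (d : ℕ) : Set where
  constructor cross-multiplied
  field cross-multiplication : ↥ q * + d ≡ a * ↧ q

/-≃ : ∀ a d .{{_ : NonZero d}} → (a /ℚ d) ≃ a / d
/-≃ a d = cross-multiplied (begin
  ↥ q * + d        ≡⟨ cong (↥ q *_) (ℚP.↧-/ a d) ⟨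
  ↥ q * (↧ q * g)  ≡⟨ shuffle (↥ q) (↧ q) g ⟩
  (↥ q * g) * ↧ q  ≡⟨ cong (_* ↧ q) (ℚP.↥-/ a d) ⟩
  a * ↧ q          ∎)
  where
  open ≡-Reasoning
  q : ℚ
  q = a /ℚ d
  g : ℤ
  g = gcdℤ a (+ d)
  shuffle : ∀ x y g → x * (y * g) ≡ (x * g) * y
  shuffle = solve-∀

≃-rescale : ∀ q {a b} X Y .{{_ : NonZero Y}} → q ≃ X / Y → X * + b ≡ a * + Y → q ≃ a / b
≃-rescale q {a} {b} X Y (cross-multiplied q≃X/Y) X/Y≡a/b = cross-multiplied (ℤP.*-cancelʳ-≡ (↥ q * + b) (a * ↧ q) (+ Y) (begin
  ↥ q * + b * + Y   ≡⟨ shuffle (↥ q) (+ b) (+ Y) ⟩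
  ↥ q * + Y * + b   ≡⟨ cong (_* + b) q≃X/Y ⟩
  X * ↧ q * + b     ≡⟨ shuffle X (↧ q) (+ b) ⟩
  X * + b * ↧ q     ≡⟨ cong (_* ↧ q) X/Y≡a/b ⟩
  a * + Y * ↧ q     ≡⟨ shuffle a (+ Y) (↧ q) ⟩
  a * ↧ q * + Y     ∎))
  where
  open ≡-Reasoning
  shuffle : ∀ x y z → x * y * z ≡ x * z * y
  shuffle = solve-∀

+-≃ : ∀ q r {a b c d} → q ≃ a / b → r ≃ c / d → (q +ℚ r) ≃ (a * + d + c * + b) / (b ℕ.* d)
+-≃ q@(mkℚ x _ _) r@(mkℚ y _ _) {a} {b} {c} {d} (cross-multiplied q≃a/b) (cross-multiplied r≃c/d) =
  ≃-rescale (q +ℚ r) X (↧ₙ q ℕ.* ↧ₙ r) (/-≃ X (↧ₙ q ℕ.* ↧ₙ r)) (begin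
    X * + (b ℕ.* d)                               ≡⟨ cong (X *_) (ℤP.pos-* b d) ⟩
    (x * ↧ r + y * ↧ q) * (+ b * + d)             ≡⟨ expand x (↧ r) y (↧ q) (+ b) (+ d) ⟩
    (x * + b) * (↧ r * + d) + (y * + d) * (↧ q * + b)
      ≡⟨ cong₂ (λ u v → u * (↧ r * + d) + v * (↧ q * + b)) q≃a/b r≃c/d ⟩
    (a * ↧ q) * (↧ r * + d) + (c * ↧ r) * (↧ q * + b) ≡⟨ collect a (↧ q) (↧ r) (+ d) c (+ b) ⟩
    (a * + d + c * + b) * (↧ q * ↧ r)             ≡⟨ cong ((a * + d + c * + b) *_) (ℤP.pos-* (↧ₙ q) (↧ₙ r)) ⟨
    (a * + d + c * + b) * + (↧ₙ q ℕ.* ↧ₙ r)       ∎)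
  where
  open ≡-Reasoning
  X : ℤ
  X = x * ↧ r + y * ↧ q
  expand : ∀ x r y q b d → (x * r + y * q) * (b * d) ≡ (x * b) * (r * d) + (y * d) * (q * b)
  expand = solve-∀
  collect : ∀ a q r d c b → (a * q) * (r * d) + (c * r) * (q * b) ≡ (a * d + c * b) * (q * r)
  collect = solve-∀

neg-≃ : ∀ q {a b} → q ≃ a / b → (-ℚ q) ≃ (- a) / b
neg-≃ q {a} {b} (cross-multiplied q≃a/b) = cross-multiplied (begin
  ↥ (-ℚ q) * + b   ≡⟨ cong (_* + b) (ℚP.↥-neg q) ⟩
  - ↥ q * + b      ≡⟨ ℤP.neg-distribˡ-* (↥ q) (+ b) ⟨
  - (↥ q * + b)    ≡⟨ cong -_ q≃a/b ⟩
  - (a * ↧ q)      ≡⟨ ℤP.neg-distribˡ-* a (↧ q) ⟩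
  - a * ↧ q        ≡⟨ cong (- a *_) (ℚP.↧-neg q) ⟨
  - a * ↧ (-ℚ q)   ∎)
  where open ≡-Reasoning

pos-^ : ∀ m n → + (m ^ n) ≡ (+ m) ℤ.^ n
pos-^ m zero = refl
pos-^ m (suc n) = trans (ℤP.pos-* m (m ^ n)) (cong (+ m *_) (pos-^ m n))

sumℚ-term-≃ : ∀ m → sumℚ m term ≃ weighted-sum m / 3 ^ m
sumℚ-term-≃ zero = cross-multiplied refl
sumℚ-term-≃ (suc m) =
  ≃-rescale (sumℚ (suc m) term) (weighted-sum m * + (3 ^ m) + + T m * + (3 ^ m)) (3 ^ m ℕ.* 3 ^ m)
    {{ℕP.m*n≢0 (3 ^ m) (3 ^ m) {{ℕP.m^n≢0 3 m}} {{ℕP.m^n≢0 3 m}}}}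
    (+-≃ (sumℚ m term) (term m) (sumℚ-term-≃ m) (/-≃ (+ T m) (3 ^ m) {{ℕP.m^n≢0 3 m}}))
    (begin
      (weighted-sum m * + (3 ^ m) + + T m * + (3 ^ m)) * + (3 ^ suc m)
        ≡⟨ cong₂ (λ u v → (weighted-sum m * u + + T m * u) * v) (pos-^ 3 m) (pos-^ 3 (suc m)) ⟩
      (weighted-sum m * t + + T m * t) * (+ 3 * t)
        ≡⟨ regroup (weighted-sum m) (+ T m) t ⟩
      (+ 3 * (weighted-sum m + + T m)) * (t * t)
        ≡⟨ cong₂ _*_ (weighted-sum-suc m) (trans (ℤP.pos-* (3 ^ m) (3 ^ m)) (cong₂ _*_ (pos-^ 3 m) (pos-^ 3 m))) ⟨
      weighted-sum (suc m) * + (3 ^ m ℕ.* 3 ^ m) ∎)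
  where
  open ≡-Reasoning
  t : ℤ
  t = (+ 3) ℤ.^ m
  regroup : ∀ x y t → (x * t + y * t) * (+ 3 * t) ≡ (+ 3 * (x + y)) * (t * t)
  regroup = solve-∀

module PrimeModulus (q : ℕ) (isPrime : Prime (suc q)) where

  p : ℕ
  p = suc q

  ∣⇒≡0-mod : ∀ {x} → p ∣ℕ ∣ x ∣ → x ≡ + 0 mod + p
  ∣⇒≡0-mod {x} p∣x = mod-by (subst (+ p ∣_) (sym (ℤP.+-identityʳ x)) (∣ᵤ⇒∣ p∣x))

  *-cancelˡ-mod : ∀ c {a b} → ¬ (p ∣ℕ ∣ c ∣) → c * a ≡ c * b mod + p → a ≡ b mod + p
  *-cancelˡ-mod c {a} {b} p∤c (mod-by p∣ca-cb)
    with euclidsLemma ∣ c ∣ ∣ a - b ∣ isPrime (subst (p ∣ℕ_) (trans (cong ∣_∣ (factor c a b)) (ℤP.abs-* c (a - b))) (∣⇒∣ᵤ p∣ca-cb))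
    where
    factor : ∀ c a b → c * a - c * b ≡ c * (a - b)
    factor = solve-∀
  ... | inj₁ p∣c = ⊥-elim (p∤c p∣c)
  ... | inj₂ p∣a-b = mod-by (∣ᵤ⇒∣ p∣a-b)

  ∤-small : ∀ {c} → 0 < c → c < p → ¬ (p ∣ℕ c)
  ∤-small {suc c} _ c<p p∣c = ℕP.<⇒≱ c<p (ℕD.∣⇒≤ p∣c)

  *-cancelˡ-mod-small : ∀ {c a b} → 0 < c → c < p → + c * a ≡ + c * b mod + p → a ≡ b mod + p
  *-cancelˡ-mod-small {c} 0<c c<p = *-cancelˡ-mod (+ c) (∤-small 0<c c<p)

  p∣pCk : ∀ {k} → 0 < k → k < p → p ∣ℕ p C k
  p∣pCk {suc k} _ k<p with euclidsLemma (suc k) (p C suc k) isPrime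
      (ℕD.divides (q C k) (trans (C-absorb q k) (ℕP.*-comm p (q C k))))
  ... | inj₁ p∣k+1 = ⊥-elim (∤-small (s≤s z≤n) k<p p∣k+1)
  ... | inj₂ p∣C = p∣C

  pCk≡0 : ∀ {k} → 0 < k → k < p → p Cℤ k ≡ + 0 mod + p
  pCk≡0 0<k k<p = ∣⇒≡0-mod (p∣pCk 0<k k<p)

  ≡0-mod⇒∣ : ∀ {x} → x ≡ + 0 mod + p → p ∣ℕ ∣ x ∣
  ≡0-mod⇒∣ {x} (mod-by p∣x-0) = subst (λ y → p ∣ℕ ∣ y ∣) (ℤP.+-identityʳ x) (∣⇒∣ᵤ p∣x-0)

  fermat : ∀ a → (+ a) ℤ.^ p ≡ + a mod + p
  fermat zero = mod-refl
  fermat (suc a) = begin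
    (+ suc a) ℤ.^ p
      ≡⟨ cong (ℤ._^ p) (a+1 a) ⟩
    (+ a + + 1) ℤ.^ p
      ≡⟨ binomial-theorem p (+ a) (+ 1) ⟩
    ∑[ i < suc p ] f i
      ≡⟨ ∑-head p f ⟩
    f 0 + (∑[ i < q ] f (suc i) + f p)
      ≈⟨ +-mod-congˡ (f 0) (+-mod-congʳ (f p) middle-terms) ⟩
    f 0 + (+ 0 + f p)
      ≡⟨ cong₂ (λ u v → u + (+ 0 + v)) f0≡1 fp≡a^p ⟩
    + 1 + (+ 0 + (+ a) ℤ.^ p)
      ≈⟨ +-mod-congˡ (+ 1) (+-mod-congˡ (+ 0) (fermat a)) ⟩
    + 1 + (+ 0 + + a)
      ≡⟨ trans (cong (_+_ (+ 1)) (ℤP.+-identityˡ (+ a))) (ℤP.+-comm (+ 1) (+ a)) ⟩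
    + a + + 1
      ≡⟨ a+1 a ⟨
    + suc a ∎
    where
    open ≡-mod-Reasoning (+ p)
    a+1 : ∀ a → + suc a ≡ + a + + 1
    a+1 a = trans (cong +_ (ℕP.+-comm 1 a)) (ℤP.pos-+ a 1)
    f : ℕ → ℤ
    f i = p Cℤ i * ((+ a) ℤ.^ i * (+ 1) ℤ.^ (p ℕ.∸ i))
    middle-terms : ∑[ i < q ] f (suc i) ≡ + 0 mod + p
    middle-terms = ∑≡0-mod q (λ i i<q → *-zeroˡ-mod ((+ a) ℤ.^ suc i * (+ 1) ℤ.^ (p ℕ.∸ suc i)) (pCk≡0 (s≤s z≤n) (s≤s i<q)))
    f0≡1 : f 0 ≡ + 1
    f0≡1 = trans (ℤP.*-identityˡ _) (trans (ℤP.*-identityˡ _) (ℤP.^-zeroˡ p))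
    fp≡a^p : f p ≡ (+ a) ℤ.^ p
    fp≡a^p = trans (cong₂ (λ c e → + c * ((+ a) ℤ.^ p * (+ 1) ℤ.^ e)) (nCn≡1 p) (ℕP.n∸n≡0 p))
                   (trans (ℤP.*-identityˡ _) (ℤP.*-identityʳ _))

  fermat-unit : ∀ {a} → 0 < a → a < p → (+ a) ℤ.^ q ≡ + 1 mod + p
  fermat-unit {a} 0<a a<p = *-cancelˡ-mod-small 0<a a<p (mod-trans (fermat a) (mod-reflexive (sym (ℤP.*-identityʳ (+ a)))))

  qCj≡sign : ∀ j → j < p → q Cℤ j ≡ sign j mod + p
  qCj≡sign zero _ = mod-refl
  qCj≡sign (suc j) j+1<p = begin
    q Cℤ suc j
      ≡⟨ isolate (q Cℤ j) (q Cℤ suc j) ⟩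
    (q Cℤ j + q Cℤ suc j) - q Cℤ j
      ≡⟨ cong (_- q Cℤ j) (C-pascal-ℤ q j) ⟨
    p Cℤ suc j - q Cℤ j
      ≈⟨ +-mod-cong (pCk≡0 (s≤s z≤n) j+1<p) (neg-mod-cong (qCj≡sign j (ℕP.<-trans (ℕP.n<1+n j) j+1<p))) ⟩
    + 0 - sign j
      ≡⟨ negate (sign j) ⟩
    sign (suc j) ∎
    where
    open ≡-mod-Reasoning (+ p)
    isolate : ∀ a b → b ≡ (a + b) - a
    isolate = solve-∀
    negate : ∀ s → + 0 - s ≡ -1ℤ * s
    negate = solve-∀

  [p+m]Ck≡mCk : ∀ m k → k < p → (p ℕ.+ m) Cℤ k ≡ m Cℤ k mod + p
  [p+m]Ck≡mCk zero zero _ = mod-refl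
  [p+m]Ck≡mCk zero (suc k) k+1<p rewrite ℕP.+-identityʳ q = pCk≡0 (s≤s z≤n) k+1<p
  [p+m]Ck≡mCk (suc m) zero _ = mod-refl
  [p+m]Ck≡mCk (suc m) (suc k) k+1<p rewrite ℕP.+-suc q m = begin
    suc (p ℕ.+ m) Cℤ suc k              ≡⟨ C-pascal-ℤ (p ℕ.+ m) k ⟩
    (p ℕ.+ m) Cℤ k + (p ℕ.+ m) Cℤ suc k ≈⟨ +-mod-cong ([p+m]Ck≡mCk m k (ℕP.<-trans (ℕP.n<1+n k) k+1<p)) ([p+m]Ck≡mCk m (suc k) k+1<p) ⟩
    m Cℤ k + m Cℤ suc k                 ≡⟨ C-pascal-ℤ m k ⟨
    suc m Cℤ suc k                      ∎
    where open ≡-mod-Reasoning (+ p)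

  [p+m]Cp≡mCp+1 : ∀ m → (p ℕ.+ m) Cℤ p ≡ m Cℤ p + + 1 mod + p
  [p+m]Cp≡mCp+1 zero rewrite ℕP.+-identityʳ q = mod-reflexive (cong +_ (nCn≡1 p))
  [p+m]Cp≡mCp+1 (suc m) rewrite ℕP.+-suc q m = begin
    suc (p ℕ.+ m) Cℤ p                  ≡⟨ C-pascal-ℤ (p ℕ.+ m) q ⟩
    (p ℕ.+ m) Cℤ q + (p ℕ.+ m) Cℤ p     ≈⟨ +-mod-cong ([p+m]Ck≡mCk m q ℕP.≤-refl) ([p+m]Cp≡mCp+1 m) ⟩
    m Cℤ q + (m Cℤ p + + 1)             ≡⟨ ℤP.+-assoc (m Cℤ q) (m Cℤ p) (+ 1) ⟨
    m Cℤ q + m Cℤ p + + 1               ≡⟨ cong (_+ + 1) (C-pascal-ℤ m q) ⟨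
    suc m Cℤ p + + 1                    ∎
    where open ≡-mod-Reasoning (+ p)

-- (1 + √-3)ᵐ = u m + v m √-3
mutual
  u : ℕ → ℤ
  u zero = + 1
  u (suc m) = u m + - + 3 * v m

  v : ℕ → ℤ
  v zero = + 0
  v (suc m) = u m + v m

even-term : ℕ → ℕ → ℤ
even-term m k = m Cℤ (k ℕ.+ k) * (- + 3) ℤ.^ k

odd-term : ℕ → ℕ → ℤ
odd-term m k = m Cℤ suc (k ℕ.+ k) * (- + 3) ℤ.^ k

u,v-closed-form : ∀ m → u m ≡ ∑< (suc m) (even-term m) × v m ≡ ∑< (suc m) (odd-term m)
u,v-closed-form zero = refl , refl
u,v-closed-form (suc m) = u-step , v-step
  where
  open ≡-Reasoning
  IHu : u m ≡ ∑< (suc m) (even-term m)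
  IHu = proj₁ (u,v-closed-form m)
  IHv : v m ≡ ∑< (suc m) (odd-term m)
  IHv = proj₂ (u,v-closed-form m)
  even : ℕ → ℤ
  even = even-term m
  odd : ℕ → ℤ
  odd = odd-term m
  even-last : even (suc m) ≡ + 0
  even-last = cong (λ c → + c * (- + 3) ℤ.^ suc m) (k>n⇒nCk≡0 (s≤s (ℕP.m≤m+n m (suc m))))
  odd-last : odd (suc m) ≡ + 0
  odd-last = cong (λ c → + c * (- + 3) ℤ.^ suc m) (k>n⇒nCk≡0 (s≤s (ℕP.≤-trans (ℕP.m≤m+n m (suc m)) (ℕP.n≤1+n _))))
  odd-suc : ∀ k → suc m Cℤ suc (k ℕ.+ k) * (- + 3) ℤ.^ k ≡ even k + odd k
  odd-suc k = trans (cong (_* (- + 3) ℤ.^ k) (C-pascal-ℤ m (k ℕ.+ k))) (ℤP.*-distribʳ-+ ((- + 3) ℤ.^ k) (m Cℤ (k ℕ.+ k)) (m Cℤ suc (k ℕ.+ k)))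
  even-suc : ∀ k → suc m Cℤ (suc k ℕ.+ suc k) * (- + 3) ℤ.^ suc k ≡ - + 3 * odd k + even (suc k)
  even-suc k = begin
    suc m Cℤ (suc k ℕ.+ suc k) * (- + 3) ℤ.^ suc k
      ≡⟨ cong (λ i → suc m Cℤ suc i * (- + 3) ℤ.^ suc k) (ℕP.+-suc k k) ⟩
    suc m Cℤ suc (suc (k ℕ.+ k)) * (- + 3) ℤ.^ suc k
      ≡⟨ cong (_* (- + 3) ℤ.^ suc k) (C-pascal-ℤ m (suc (k ℕ.+ k))) ⟩
    (m Cℤ suc (k ℕ.+ k) + m Cℤ suc (suc (k ℕ.+ k))) * (- + 3) ℤ.^ suc k
      ≡⟨ cong (λ i → (m Cℤ suc (k ℕ.+ k) + m Cℤ i) * (- + 3) ℤ.^ suc k) (ℕP.+-suc (suc k) k) ⟨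
    (m Cℤ suc (k ℕ.+ k) + m Cℤ (suc k ℕ.+ suc k)) * (- + 3) ℤ.^ suc k
      ≡⟨ distribute (m Cℤ suc (k ℕ.+ k)) (m Cℤ (suc k ℕ.+ suc k)) ((- + 3) ℤ.^ k) ⟩
    - + 3 * odd k + even (suc k) ∎
    where
    distribute : ∀ a b y → (a + b) * (- + 3 * y) ≡ - + 3 * (a * y) + b * (- + 3 * y)
    distribute = solve-∀
  v-step : v (suc m) ≡ ∑< (suc (suc m)) (odd-term (suc m))
  v-step = begin
    u m + v m
      ≡⟨ cong₂ _+_ IHu IHv ⟩
    ∑< (suc m) even + ∑< (suc m) odd
      ≡⟨ cong₂ _+_ (trans (cong (_+_ (∑< (suc m) even)) even-last) (ℤP.+-identityʳ (∑< (suc m) even)))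
                   (trans (cong (_+_ (∑< (suc m) odd)) odd-last) (ℤP.+-identityʳ (∑< (suc m) odd))) ⟨
    ∑< (suc (suc m)) even + ∑< (suc (suc m)) odd
      ≡⟨ ∑-distrib-+ (suc (suc m)) even odd ⟨
    ∑[ k < suc (suc m) ] (even k + odd k)
      ≡⟨ ∑-cong (suc (suc m)) (λ k _ → odd-suc k) ⟨
    ∑< (suc (suc m)) (odd-term (suc m)) ∎
  u-step : u (suc m) ≡ ∑< (suc (suc m)) (even-term (suc m))
  u-step = begin
    u m + - + 3 * v m
      ≡⟨ cong₂ (λ a b → a + - + 3 * b) IHu IHv ⟩
    ∑< (suc m) even + - + 3 * ∑< (suc m) odd
      ≡⟨ cong₂ _+_ (∑-head m even) (sym (*-distribˡ-∑ (suc m) (- + 3) odd)) ⟩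
    (+ 1 + ∑[ k < m ] even (suc k)) + ∑[ k < suc m ] (- + 3 * odd k)
      ≡⟨ cong (λ x → (+ 1 + x) + ∑[ k < suc m ] (- + 3 * odd k))
           (trans (sym (ℤP.+-identityʳ (∑[ k < m ] even (suc k)))) (cong (_+_ (∑[ k < m ] even (suc k))) (sym even-last))) ⟩
    (+ 1 + ∑[ k < suc m ] even (suc k)) + ∑[ k < suc m ] (- + 3 * odd k)
      ≡⟨ regroup (+ 1) (∑[ k < suc m ] even (suc k)) (∑[ k < suc m ] (- + 3 * odd k)) ⟩
    + 1 + (∑[ k < suc m ] (- + 3 * odd k) + ∑[ k < suc m ] even (suc k))
      ≡⟨ cong (_+_ (+ 1)) (∑-distrib-+ (suc m) (λ k → - + 3 * odd k) (λ k → even (suc k))) ⟨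
    + 1 + ∑[ k < suc m ] (- + 3 * odd k + even (suc k))
      ≡⟨ cong (_+_ (+ 1)) (∑-cong (suc m) (λ k _ → even-suc k)) ⟨
    + 1 + ∑[ k < suc m ] (suc m Cℤ (suc k ℕ.+ suc k) * (- + 3) ℤ.^ suc k)
      ≡⟨ ∑-head (suc m) (λ k → suc m Cℤ (k ℕ.+ k) * (- + 3) ℤ.^ k) ⟨
    ∑< (suc (suc m)) (even-term (suc m)) ∎
    where
    regroup : ∀ a x y → (a + x) + y ≡ a + (y + x)
    regroup = solve-∀

-- (1 + √-3)³ = -8
v-period : ∀ m → v (3 ℕ.+ m) ≡ - + 8 * v m
v-period m = expand (u m) (v m)
  where
  expand : ∀ a b → ((a + - + 3 * b) + - + 3 * (a + b)) + ((a + - + 3 * b) + (a + b)) ≡ - + 8 * b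
  expand = solve-∀

v-1+3k : ∀ k → v (suc (k ℕ.* 3)) ≡ (- + 2) ℤ.^ (k ℕ.* 3)
v-1+3k zero = refl
v-1+3k (suc k) = trans (v-period (suc (k ℕ.* 3))) (trans (cong (- + 8 *_) (v-1+3k k)) (cube ((- + 2) ℤ.^ (k ℕ.* 3))))
  where
  cube : ∀ x → - + 8 * x ≡ - + 2 * (- + 2 * (- + 2 * x))
  cube = solve-∀

v-2+3k : ∀ k → v (suc (suc (k ℕ.* 3))) ≡ - (- + 2) ℤ.^ suc (k ℕ.* 3)
v-2+3k zero = refl
v-2+3k (suc k) = trans (v-period (suc (suc (k ℕ.* 3)))) (trans (cong (- + 8 *_) (v-2+3k k)) (cube ((- + 2) ℤ.^ (k ℕ.* 3))))
  where
  cube : ∀ x → - + 8 * - (- + 2 * x) ≡ - (- + 2 * (- + 2 * (- + 2 * (- + 2 * x))))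
  cube = solve-∀

+suc-double : ∀ j → + suc (j ℕ.+ j) ≡ + 1 + (+ j + + j)
+suc-double j = trans (ℤP.pos-+ 1 (j ℕ.+ j)) (cong (_+_ (+ 1)) (ℤP.pos-+ j j))

module OddPrime (n : ℕ) (isPrime : Prime (suc (n ℕ.+ n))) (2≤n : 2 ≤ n) where

  open PrimeModulus (n ℕ.+ n) isPrime

  ≤n⇒<p : ∀ {j} → j ≤ n → suc j < p
  ≤n⇒<p j≤n = s≤s (ℕP.≤-trans (s≤s j≤n) (ℕP.m<n+m n (ℕP.<-≤-trans (s≤s z≤n) 2≤n)))

  -- The ratios of consecutive terms, 2(2j+1)/(j+1) and -4(n-j)/(j+1), agree modulo 2n+1.
  central≡[-4]^j*nCj : ∀ j → j ≤ n → central j ≡ (- + 4) ℤ.^ j * n Cℤ j mod + p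
  central≡[-4]^j*nCj zero _ = mod-refl
  central≡[-4]^j*nCj (suc j) j+1≤n = *-cancelˡ-mod-small (s≤s z≤n) (≤n⇒<p j≤n) (begin
    + suc j * central (suc j)
      ≡⟨ central-suc j ⟩
    + 2 * + suc (j ℕ.+ j) * central j
      ≈⟨ *-mod-congˡ (+ 2 * + suc (j ℕ.+ j)) (central≡[-4]^j*nCj j j≤n) ⟩
    + 2 * + suc (j ℕ.+ j) * (a * c)
      ≡⟨ split-off-p ⟩
    (- + 4) * a * ((+ n - + j) * c) + (+ 2 * (a * c)) * + p
      ≈⟨ +-mod-congˡ ((- + 4) * a * ((+ n - + j) * c)) (multiple≡0 (+ 2 * (a * c))) ⟩
    (- + 4) * a * ((+ n - + j) * c) + + 0
      ≡⟨ trans (ℤP.+-identityʳ _) (cong ((- + 4) * a *_) (sym (C-suc-ratio n j))) ⟩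
    (- + 4) * a * (+ suc j * n Cℤ suc j)
      ≡⟨ commute (+ suc j) ((- + 4) * a) (n Cℤ suc j) ⟩
    + suc j * ((- + 4) ℤ.^ suc j * n Cℤ suc j) ∎)
    where
    open ≡-mod-Reasoning (+ p)
    j≤n : j ≤ n
    j≤n = ℕP.≤-trans (ℕP.n≤1+n j) j+1≤n
    a : ℤ
    a = (- + 4) ℤ.^ j
    c : ℤ
    c = n Cℤ j
    identity : ∀ j n a c → + 2 * (+ 1 + (j + j)) * (a * c) ≡ (- + 4) * a * ((n - j) * c) + (+ 2 * (a * c)) * (+ 1 + (n + n))
    identity = solve-∀
    split-off-p : + 2 * + suc (j ℕ.+ j) * (a * c) ≡ (- + 4) * a * ((+ n - + j) * c) + (+ 2 * (a * c)) * + p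
    split-off-p = trans (cong (λ x → + 2 * x * (a * c)) (+suc-double j))
                        (trans (identity (+ j) (+ n) a c) (cong (λ x → (- + 4) * a * ((+ n - + j) * c) + (+ 2 * (a * c)) * x) (sym (+suc-double n))))
    commute : ∀ s x c → x * (s * c) ≡ s * (x * c)
    commute = solve-∀

  central≡0 : ∀ j → n < j → j ≤ n ℕ.+ n → central j ≡ + 0 mod + p
  central≡0 (suc j) (s≤s n≤j) j+1≤2n = *-cancelˡ-mod-small (s≤s z≤n) (s≤s j+1≤2n) (begin
    + suc j * central (suc j)          ≡⟨ central-suc j ⟩
    + 2 * + suc (j ℕ.+ j) * central j  ≈⟨ previous (ℕP.m≤n⇒m<n∨m≡n n≤j) ⟩
    + 0                                ≡⟨ ℤP.*-zeroʳ (+ suc j) ⟨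
    + suc j * + 0                      ∎)
    where
    open ≡-mod-Reasoning (+ p)
    previous : n ℕ.< j ⊎ n ≡ j → + 2 * + suc (j ℕ.+ j) * central j ≡ + 0 mod + p
    previous (inj₁ n<j) = *-zeroʳ-mod (+ 2 * + suc (j ℕ.+ j)) (central≡0 j n<j (ℕP.≤-trans (ℕP.n≤1+n j) j+1≤2n))
    previous (inj₂ refl) = mod-trans (mod-reflexive (reorder (+ 2) (+ p) (central n))) (multiple≡0 (+ 2 * central n))
      where
      reorder : ∀ a b c → a * b * c ≡ a * c * b
      reorder = solve-∀

  -- D_j of the proof idea; the division is exact for j ≤ 2n (p*D).
  D : ℕ → ℕ
  D j = (((j ℕ.+ j) C j) ℕ.* (p C suc j)) ℕ./ p

  p*D : ∀ j → j ≤ n ℕ.+ n → p ℕ.* D j ≡ ((j ℕ.+ j) C j) ℕ.* (p C suc j)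
  p*D j j≤2n = m*[n/m]≡n (p∣product (ℕP.m≤n⇒m<n∨m≡n j≤2n))
    where
    p∣product : j < n ℕ.+ n ⊎ j ≡ n ℕ.+ n → p ∣ℕ ((j ℕ.+ j) C j) ℕ.* (p C suc j)
    p∣product (inj₁ j<2n) = ℕD.∣n⇒∣m*n ((j ℕ.+ j) C j) (p∣pCk (s≤s z≤n) (s≤s j<2n))
    p∣product (inj₂ refl) =
      ℕD.∣m⇒∣m*n (p C suc (n ℕ.+ n)) (≡0-mod⇒∣ (central≡0 (n ℕ.+ n) (ℕP.m<m+n n (ℕP.<-≤-trans (s≤s z≤n) 2≤n)) ℕP.≤-refl))

  p*D-ℤ : ∀ j → j ≤ n ℕ.+ n → + p * + D j ≡ central j * p Cℤ suc j
  p*D-ℤ j j≤2n = trans (sym (ℤP.pos-* p (D j))) (trans (cong +_ (p*D j j≤2n)) (ℤP.pos-* ((j ℕ.+ j) C j) (p C suc j)))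

  [j+1]*D : ∀ j → j ≤ n ℕ.+ n → suc j ℕ.* D j ≡ ((j ℕ.+ j) C j) ℕ.* ((n ℕ.+ n) C j)
  [j+1]*D j j≤2n = ℕP.*-cancelˡ-≡ _ _ p (begin
    p ℕ.* (suc j ℕ.* D j)            ≡⟨ swap p (suc j) (D j) ⟩
    suc j ℕ.* (p ℕ.* D j)            ≡⟨ cong (suc j ℕ.*_) (p*D j j≤2n) ⟩
    suc j ℕ.* (c ℕ.* (p C suc j))    ≡⟨ swap (suc j) c _ ⟩
    c ℕ.* (suc j ℕ.* (p C suc j))    ≡⟨ cong (c ℕ.*_) (C-absorb (n ℕ.+ n) j) ⟩
    c ℕ.* (p ℕ.* ((n ℕ.+ n) C j))    ≡⟨ swap c p _ ⟩
    p ℕ.* (c ℕ.* ((n ℕ.+ n) C j))    ∎)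
    where
    open ≡-Reasoning
    c : ℕ
    c = (j ℕ.+ j) C j
    swap : ∀ a b x → a ℕ.* (b ℕ.* x) ≡ b ℕ.* (a ℕ.* x)
    swap = ℕ-solve-∀

  [j+1]*D-ℤ : ∀ j → j ≤ n ℕ.+ n → + suc j * + D j ≡ central j * (n ℕ.+ n) Cℤ j
  [j+1]*D-ℤ j j≤2n = trans (sym (ℤP.pos-* (suc j) (D j))) (trans (cong +_ ([j+1]*D j j≤2n)) (ℤP.pos-* ((j ℕ.+ j) C j) _))

  D-middle : ∀ j → n < j → j < n ℕ.+ n → + D j ≡ + 0 mod + p
  D-middle j n<j j<2n = *-cancelˡ-mod-small (s≤s z≤n) (s≤s j<2n) (begin
    + suc j * + D j                  ≡⟨ [j+1]*D-ℤ j (ℕP.<⇒≤ j<2n) ⟩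
    central j * (n ℕ.+ n) Cℤ j       ≈⟨ *-mod-congʳ ((n ℕ.+ n) Cℤ j) (central≡0 j n<j (ℕP.<⇒≤ j<2n)) ⟩
    + 0                              ≡⟨ ℤP.*-zeroʳ (+ suc j) ⟨
    + suc j * + 0                    ∎)
    where open ≡-mod-Reasoning (+ p)

  C[p+2n,p]≡[p+2n]*D : (p ℕ.+ (n ℕ.+ n)) C p ≡ (p ℕ.+ (n ℕ.+ n)) ℕ.* D (n ℕ.+ n)
  C[p+2n,p]≡[p+2n]*D = ℕP.*-cancelˡ-≡ _ _ p (begin
    p ℕ.* (m C p)                   ≡⟨ C-absorb (n ℕ.+ n ℕ.+ (n ℕ.+ n)) (n ℕ.+ n) ⟩
    m ℕ.* c                         ≡⟨ cong (m ℕ.*_) (trans (sym (ℕP.*-identityʳ c)) (cong (c ℕ.*_) (sym (nCn≡1 p)))) ⟩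
    m ℕ.* (c ℕ.* (p C p))           ≡⟨ cong (m ℕ.*_) (p*D (n ℕ.+ n) ℕP.≤-refl) ⟨
    m ℕ.* (p ℕ.* D (n ℕ.+ n))       ≡⟨ swap m p (D (n ℕ.+ n)) ⟩
    p ℕ.* (m ℕ.* D (n ℕ.+ n))       ∎)
    where
    open ≡-Reasoning
    m : ℕ
    m = p ℕ.+ (n ℕ.+ n)
    c : ℕ
    c = (n ℕ.+ n ℕ.+ (n ℕ.+ n)) C (n ℕ.+ n)
    swap : ∀ a b x → a ℕ.* (b ℕ.* x) ≡ b ℕ.* (a ℕ.* x)
    swap = ℕ-solve-∀

  D-last : + D (n ℕ.+ n) ≡ - + 1 mod + p
  D-last = mod-trans (mod-reflexive (sym (ℤP.neg-involutive _))) (neg-mod-cong (begin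
    - + d                           ≡⟨ ℤP.+-identityˡ _ ⟨
    + 0 + - + d                     ≈⟨ +-mod-congʳ (- + d) (multiple≡0 (+ 2 * + d)) ⟨
    + 2 * + d * + p + - + d         ≡⟨ rearrange (+ p) (+ d) ⟩
    (+ 2 * + p - + 1) * + d         ≡⟨ cong (_* + d) 2p-1 ⟨
    + (p ℕ.+ (n ℕ.+ n)) * + d       ≡⟨ trans (sym (ℤP.pos-* (p ℕ.+ (n ℕ.+ n)) d)) (cong +_ (sym C[p+2n,p]≡[p+2n]*D)) ⟩
    (p ℕ.+ (n ℕ.+ n)) Cℤ p          ≈⟨ [p+m]Cp≡mCp+1 (n ℕ.+ n) ⟩
    (n ℕ.+ n) Cℤ p + + 1            ≡⟨ cong (λ c → + c + + 1) (k>n⇒nCk≡0 (ℕP.n<1+n (n ℕ.+ n))) ⟩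
    + 0 + + 1                       ≡⟨ ℤP.+-identityˡ (+ 1) ⟩
    + 1                             ∎))
    where
    open ≡-mod-Reasoning (+ p)
    d : ℕ
    d = D (n ℕ.+ n)
    rearrange : ∀ p d → + 2 * d * p + - d ≡ (+ 2 * p - + 1) * d
    rearrange = solve-∀
    2p-1 : + (p ℕ.+ (n ℕ.+ n)) ≡ + 2 * + p - + 1
    2p-1 = trans (ℤP.pos-+ p (n ℕ.+ n)) (trans (cong (_+ + (n ℕ.+ n)) (+suc-double n))
             (trans (identity (+ n)) (cong (λ x → + 2 * x - + 1) (sym (+suc-double n)))))
      where
      identity : ∀ n → + 1 + (n + n) + (n + n) ≡ + 2 * (+ 1 + (n + n)) - + 1
      identity = solve-∀

  [n+1]*D : ∀ j → j ≤ n → + suc n * + D j ≡ (- + 4) ℤ.^ j * sign j * suc n Cℤ suc j mod + p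
  [n+1]*D j j≤n = *-cancelˡ-mod-small (s≤s z≤n) (≤n⇒<p j≤n) (begin
    + suc j * (+ suc n * + D j)
      ≡⟨ swap (+ suc j) (+ suc n) (+ D j) ⟩
    + suc n * (+ suc j * + D j)
      ≡⟨ cong (+ suc n *_) ([j+1]*D-ℤ j j≤2n) ⟩
    + suc n * (central j * (n ℕ.+ n) Cℤ j)
      ≈⟨ *-mod-congˡ (+ suc n) (*-mod-cong (central≡[-4]^j*nCj j j≤n) (qCj≡sign j (ℕP.<-trans (ℕP.n<1+n j) (≤n⇒<p j≤n)))) ⟩
    + suc n * ((- + 4) ℤ.^ j * n Cℤ j * sign j)
      ≡⟨ shuffle (+ suc n) ((- + 4) ℤ.^ j) (n Cℤ j) (sign j) ⟩
    (- + 4) ℤ.^ j * sign j * (+ suc n * n Cℤ j)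
      ≡⟨ cong ((- + 4) ℤ.^ j * sign j *_) absorb ⟩
    (- + 4) ℤ.^ j * sign j * (+ suc j * suc n Cℤ suc j)
      ≡⟨ swap ((- + 4) ℤ.^ j * sign j) (+ suc j) (suc n Cℤ suc j) ⟩
    + suc j * ((- + 4) ℤ.^ j * sign j * suc n Cℤ suc j) ∎)
    where
    open ≡-mod-Reasoning (+ p)
    j≤2n : j ≤ n ℕ.+ n
    j≤2n = ℕP.≤-trans j≤n (ℕP.m≤m+n n n)
    swap : ∀ a b x → a * (b * x) ≡ b * (a * x)
    swap = solve-∀
    shuffle : ∀ m a c s → m * (a * c * s) ≡ a * s * (m * c)
    shuffle = solve-∀
    absorb : + suc n * n Cℤ j ≡ + suc j * suc n Cℤ suc j
    absorb = trans (sym (ℤP.pos-* (suc n) (n C j))) (trans (cong +_ (sym (C-absorb n j))) (ℤP.pos-* (suc j) _))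

  f : ℕ → ℤ
  f j = (+ 3) ℤ.^ (p ℕ.∸ j) * sign j * + D j

  weighted-sum≡p*∑f : weighted-sum p ≡ + p * ∑< p f
  weighted-sum≡p*∑f = begin
    weighted-sum p
      ≡⟨ weighted-sum-closed-form p ⟩
    ∑[ j < p ] (p Cℤ suc j * ((+ 3) ℤ.^ (p ℕ.∸ j) * (sign j * central j)))
      ≡⟨ ∑-cong p (λ j j<p → summand j (ℕP.≤-pred j<p)) ⟩
    ∑[ j < p ] (+ p * f j)
      ≡⟨ *-distribˡ-∑ p (+ p) f ⟩
    + p * ∑< p f ∎
    where
    open ≡-Reasoning
    shuffle : ∀ C t s c → C * (t * (s * c)) ≡ t * s * (c * C)
    shuffle = solve-∀
    swap : ∀ x p d → x * (p * d) ≡ p * (x * d)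
    swap = solve-∀
    summand : ∀ j → j ≤ n ℕ.+ n → p Cℤ suc j * ((+ 3) ℤ.^ (p ℕ.∸ j) * (sign j * central j)) ≡ + p * f j
    summand j j≤2n = begin
      p Cℤ suc j * ((+ 3) ℤ.^ (p ℕ.∸ j) * (sign j * central j))
        ≡⟨ shuffle (p Cℤ suc j) ((+ 3) ℤ.^ (p ℕ.∸ j)) (sign j) (central j) ⟩
      (+ 3) ℤ.^ (p ℕ.∸ j) * sign j * (central j * p Cℤ suc j)
        ≡⟨ cong ((+ 3) ℤ.^ (p ℕ.∸ j) * sign j *_) (p*D-ℤ j j≤2n) ⟨
      (+ 3) ℤ.^ (p ℕ.∸ j) * sign j * (+ p * + D j)
        ≡⟨ swap ((+ 3) ℤ.^ (p ℕ.∸ j) * sign j) (+ p) (+ D j) ⟩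
      + p * f j ∎

  low-sum : ℤ
  low-sum = ∑< (suc n) f

  high-sum : ℤ
  high-sum = ∑[ i < n ] f (suc n ℕ.+ i)

  t : ℤ
  t = (+ 3) ℤ.^ n

  z-term : ℕ → ℤ
  z-term j = suc n Cℤ suc j * ((- + 4) ℤ.^ j * (+ 3) ℤ.^ (n ℕ.∸ j))

  Z : ℤ
  Z = ∑< (suc n) z-term

  -- (-4 + 3)ⁿ⁺¹ expanded by the binomial theorem
  Z-identity : - + 4 * Z ≡ sign (suc n) - + 3 * t
  Z-identity = begin
    - + 4 * Z
      ≡⟨ isolate (+ 3 * t) (- + 4 * Z) ⟩
    (+ 3 * t + - + 4 * Z) - + 3 * t
      ≡⟨ cong (_- + 3 * t) expansion ⟨
    (- + 4 + + 3) ℤ.^ suc n - + 3 * t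
      ≡⟨⟩
    sign (suc n) - + 3 * t ∎
    where
    open ≡-Reasoning
    isolate : ∀ a x → x ≡ (a + x) - a
    isolate = solve-∀
    pull-4 : ∀ C a u → C * ((- + 4 * a) * u) ≡ - + 4 * (C * (a * u))
    pull-4 = solve-∀
    expansion : (- + 4 + + 3) ℤ.^ suc n ≡ + 3 * t + - + 4 * Z
    expansion = trans (binomial-theorem (suc n) (- + 4) (+ 3)) (trans (∑-head (suc n) _)
      (cong₂ _+_ (trans (ℤP.*-identityˡ (+ 1 * (+ 3 * t))) (ℤP.*-identityˡ (+ 3 * t)))
                 (trans (∑-cong (suc n) (λ j _ → pull-4 (suc n Cℤ suc j) ((- + 4) ℤ.^ j) ((+ 3) ℤ.^ (n ℕ.∸ j))))
                        (*-distribˡ-∑ (suc n) (- + 4) _))))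

  [n+1]*low-sum : + suc n * low-sum ≡ + 3 * t * Z mod + p
  [n+1]*low-sum = begin
    + suc n * low-sum
      ≡⟨ *-distribˡ-∑ (suc n) (+ suc n) f ⟨
    ∑[ j < suc n ] (+ suc n * f j)
      ≈⟨ ∑-cong-mod (suc n) {f = λ j → + suc n * f j} {g = λ j → + 3 * t * z-term j} (λ j j<1+n → summand j (ℕP.≤-pred j<1+n)) ⟩
    ∑[ j < suc n ] (+ 3 * t * z-term j)
      ≡⟨ *-distribˡ-∑ (suc n) (+ 3 * t) _ ⟩
    + 3 * t * Z ∎
    where
    open ≡-mod-Reasoning (+ p)
    pull : ∀ m u s d → m * (u * s * d) ≡ u * s * (m * d)
    pull = solve-∀
    cancel-signs : ∀ u s a C → u * s * (a * s * C) ≡ (s * s) * (u * (a * C))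
    cancel-signs = solve-∀
    regroup : ∀ T u a C → T * u * (a * C) ≡ T * (C * (a * u))
    regroup = solve-∀
    summand : ∀ j → j ≤ n → + suc n * f j ≡ + 3 * t * z-term j mod + p
    summand j j≤n = begin
      + suc n * f j
        ≡⟨ pull (+ suc n) ((+ 3) ℤ.^ (p ℕ.∸ j)) (sign j) (+ D j) ⟩
      (+ 3) ℤ.^ (p ℕ.∸ j) * sign j * (+ suc n * + D j)
        ≈⟨ *-mod-congˡ ((+ 3) ℤ.^ (p ℕ.∸ j) * sign j) ([n+1]*D j j≤n) ⟩
      (+ 3) ℤ.^ (p ℕ.∸ j) * sign j * ((- + 4) ℤ.^ j * sign j * suc n Cℤ suc j)
        ≡⟨ cancel-signs ((+ 3) ℤ.^ (p ℕ.∸ j)) (sign j) ((- + 4) ℤ.^ j) (suc n Cℤ suc j) ⟩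
      (sign j * sign j) * ((+ 3) ℤ.^ (p ℕ.∸ j) * ((- + 4) ℤ.^ j * suc n Cℤ suc j))
        ≡⟨ trans (cong (_* ((+ 3) ℤ.^ (p ℕ.∸ j) * ((- + 4) ℤ.^ j * suc n Cℤ suc j))) (sign-square j)) (ℤP.*-identityˡ _) ⟩
      (+ 3) ℤ.^ (p ℕ.∸ j) * ((- + 4) ℤ.^ j * suc n Cℤ suc j)
        ≡⟨ cong (λ e → (+ 3) ℤ.^ e * ((- + 4) ℤ.^ j * suc n Cℤ suc j)) (ℕP.+-∸-assoc (suc n) j≤n) ⟩
      (+ 3) ℤ.^ (suc n ℕ.+ (n ℕ.∸ j)) * ((- + 4) ℤ.^ j * suc n Cℤ suc j)
        ≡⟨ cong (_* ((- + 4) ℤ.^ j * suc n Cℤ suc j)) (ℤP.^-distribˡ-+-* (+ 3) (suc n) (n ℕ.∸ j)) ⟩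
      + 3 * t * (+ 3) ℤ.^ (n ℕ.∸ j) * ((- + 4) ℤ.^ j * suc n Cℤ suc j)
        ≡⟨ regroup (+ 3 * t) ((+ 3) ℤ.^ (n ℕ.∸ j)) ((- + 4) ℤ.^ j) (suc n Cℤ suc j) ⟩
      + 3 * t * z-term j ∎

  n-1 : ℕ
  n-1 = ℕ.pred n

  1+[n-1]≡n : suc n-1 ≡ n
  1+[n-1]≡n = ℕP.suc-pred n {{ℕ.>-nonZero (ℕP.<-≤-trans (s≤s z≤n) 2≤n)}}

  high-sum≡-3 : high-sum ≡ - + 3 mod + p
  high-sum≡-3 = begin
    high-sum
      ≡⟨ cong (λ k → ∑[ i < k ] f (suc n ℕ.+ i)) 1+[n-1]≡n ⟨
    ∑[ i < n-1 ] f (suc n ℕ.+ i) + f (suc n ℕ.+ n-1)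
      ≈⟨ +-mod-cong (∑≡0-mod n-1 middle) (mod-reflexive (cong f last-index)) ⟩
    + 0 + f (n ℕ.+ n)
      ≡⟨ ℤP.+-identityˡ _ ⟩
    (+ 3) ℤ.^ (p ℕ.∸ (n ℕ.+ n)) * sign (n ℕ.+ n) * + D (n ℕ.+ n)
      ≡⟨ cong₂ (λ e s → (+ 3) ℤ.^ e * s * + D (n ℕ.+ n)) (ℕP.m+n∸n≡m 1 (n ℕ.+ n)) (sign-even n) ⟩
    + 3 * + 1 * + 1 * + D (n ℕ.+ n)
      ≈⟨ *-mod-congˡ (+ 3 * + 1 * + 1) D-last ⟩
    - + 3 ∎
    where
    open ≡-mod-Reasoning (+ p)
    last-index : suc n ℕ.+ n-1 ≡ n ℕ.+ n
    last-index = trans (sym (ℕP.+-suc n n-1)) (cong (n ℕ.+_) 1+[n-1]≡n)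
    middle : ∀ i → i < n-1 → f (suc n ℕ.+ i) ≡ + 0 mod + p
    middle i i<n-1 = *-zeroʳ-mod ((+ 3) ℤ.^ (p ℕ.∸ (suc n ℕ.+ i)) * sign (suc n ℕ.+ i))
                                 (D-middle (suc n ℕ.+ i) (s≤s (ℕP.m≤m+n n i)) below-2n)
      where
      below-2n : suc n ℕ.+ i < n ℕ.+ n
      below-2n = subst (_< n ℕ.+ n) (ℕP.+-suc n i) (ℕP.+-monoʳ-< n (subst (suc i <_) 1+[n-1]≡n (s≤s i<n-1)))

  3<p : 3 < p
  3<p = s≤s (ℕP.≤-trans (s≤s (s≤s (s≤s z≤n))) (ℕP.+-mono-≤ 2≤n 2≤n))

  t²≡1 : t * t ≡ + 1 mod + p
  t²≡1 = mod-trans (mod-reflexive (sym (ℤP.^-distribˡ-+-* (+ 3) n n))) (fermat-unit (s≤s z≤n) 3<p)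

  -- Since 2(n+1) = p + 1, multiplying by -8(n+1) acts as multiplication by -4 modulo p.
  -4*∑f : - + 4 * ∑< p f ≡ - + 6 * (t * sign n) - + 6 mod + p
  -4*∑f = begin
    - + 4 * ∑< p f
      ≡⟨ cong (- + 4 *_) (∑-split (suc n) n f) ⟩
    - + 4 * (A + B)
      ≡⟨ trans (split-p A B (+ n)) (cong₂ (λ m q → - + 8 * (m * A) + - + 8 * m * B + + 4 * (A + B) * q) (sym (ℤP.pos-+ 1 n)) (sym (+suc-double n))) ⟩
    - + 8 * (+ suc n * A) + - + 8 * + suc n * B + + 4 * (A + B) * + p
      ≈⟨ +-mod-cong (+-mod-cong (*-mod-congˡ (- + 8) [n+1]*low-sum) (*-mod-congˡ (- + 8 * + suc n) high-sum≡-3)) (multiple≡0 (+ 4 * (A + B))) ⟩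
    - + 8 * (+ 3 * t * Z) + - + 8 * + suc n * - + 3 + + 0
      ≡⟨ trans (cong (λ m → - + 8 * (+ 3 * t * Z) + - + 8 * m * - + 3 + + 0) (ℤP.pos-+ 1 n))
               (trans (collect t Z (+ n)) (cong (λ q → + 6 * t * (- + 4 * Z) + + 12 * q + + 12) (sym (+suc-double n)))) ⟩
    + 6 * t * (- + 4 * Z) + + 12 * + p + + 12
      ≈⟨ +-mod-congʳ (+ 12) (+-mod-congˡ (+ 6 * t * (- + 4 * Z)) (multiple≡0 (+ 12))) ⟩
    + 6 * t * (- + 4 * Z) + + 0 + + 12
      ≡⟨ cong (λ z → + 6 * t * z + + 0 + + 12) Z-identity ⟩
    + 6 * t * (sign (suc n) - + 3 * t) + + 0 + + 12
      ≡⟨ expand t (sign n) ⟩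
    - + 6 * (t * sign n) + - + 18 * (t * t) + + 12
      ≈⟨ +-mod-congʳ (+ 12) (+-mod-congˡ (- + 6 * (t * sign n)) (*-mod-congˡ (- + 18) t²≡1)) ⟩
    - + 6 * (t * sign n) + - + 18 * + 1 + + 12
      ≡⟨ simplify (t * sign n) ⟩
    - + 6 * (t * sign n) - + 6 ∎
    where
    open ≡-mod-Reasoning (+ p)
    A : ℤ
    A = low-sum
    B : ℤ
    B = high-sum
    split-p : ∀ A B n → - + 4 * (A + B) ≡ - + 8 * ((+ 1 + n) * A) + - + 8 * (+ 1 + n) * B + + 4 * (A + B) * (+ 1 + (n + n))
    split-p = solve-∀
    collect : ∀ t Z n → - + 8 * (+ 3 * t * Z) + - + 8 * (+ 1 + n) * - + 3 + + 0 ≡ + 6 * t * (- + 4 * Z) + + 12 * (+ 1 + (n + n)) + + 12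
    collect = solve-∀
    expand : ∀ t s → + 6 * t * (-1ℤ * s - + 3 * t) + + 0 + + 12 ≡ - + 6 * (t * s) + - + 18 * (t * t) + + 12
    expand = solve-∀
    simplify : ∀ x → - + 6 * x + - + 18 * + 1 + + 12 ≡ - + 6 * x - + 6
    simplify = solve-∀

  -4-cancel : ∀ {a b} → - + 4 * a ≡ - + 4 * b mod + p → a ≡ b mod + p
  -4-cancel = *-cancelˡ-mod (- + 4) (∤-small (s≤s z≤n) (s≤s (ℕP.+-mono-≤ 2≤n 2≤n)))

  ∑f≡3^p : t * sign n ≡ + 1 mod + p → ∑< p f ≡ (+ 3) ℤ.^ p mod + p
  ∑f≡3^p ε≡1 = -4-cancel (begin
    - + 4 * ∑< p f                  ≈⟨ -4*∑f ⟩
    - + 6 * (t * sign n) - + 6      ≈⟨ +-mod-congʳ (- + 6) (*-mod-congˡ (- + 6) ε≡1) ⟩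
    - + 4 * + 3                     ≈⟨ *-mod-congˡ (- + 4) (fermat 3) ⟨
    - + 4 * (+ 3) ℤ.^ p             ∎)
    where open ≡-mod-Reasoning (+ p)

  ∑f≡0 : t * sign n ≡ - + 1 mod + p → ∑< p f ≡ + 0 mod + p
  ∑f≡0 ε≡-1 = -4-cancel (begin
    - + 4 * ∑< p f                  ≈⟨ -4*∑f ⟩
    - + 6 * (t * sign n) - + 6      ≈⟨ +-mod-congʳ (- + 6) (*-mod-congˡ (- + 6) ε≡-1) ⟩
    - + 4 * + 0                     ∎)
    where open ≡-mod-Reasoning (+ p)

  v-p : v p ≡ (- + 3) ℤ.^ n mod + p
  v-p = begin
    v p
      ≡⟨ proj₂ (u,v-closed-form p) ⟩
    ∑< (suc p) (odd-term p)
      ≡⟨ cong (λ m → ∑< m (odd-term p)) 1+p≡n+[n+2] ⟩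
    ∑< (n ℕ.+ suc (suc n)) (odd-term p)
      ≡⟨ ∑-split n (suc (suc n)) (odd-term p) ⟩
    ∑< n (odd-term p) + ∑[ i < suc (suc n) ] odd-term p (n ℕ.+ i)
      ≡⟨ cong (_+_ (∑< n (odd-term p))) (∑-head (suc n) (λ i → odd-term p (n ℕ.+ i))) ⟩
    ∑< n (odd-term p) + (odd-term p (n ℕ.+ 0) + ∑[ i < suc n ] odd-term p (n ℕ.+ suc i))
      ≈⟨ +-mod-cong (∑≡0-mod n below) (mod-reflexive (cong₂ _+_ at-n (∑-zero (suc n) (λ i _ → above i)))) ⟩
    + 0 + ((- + 3) ℤ.^ n + + 0)
      ≡⟨ trans (ℤP.+-identityˡ _) (ℤP.+-identityʳ _) ⟩
    (- + 3) ℤ.^ n ∎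
    where
    open ≡-mod-Reasoning (+ p)
    1+p≡n+[n+2] : suc p ≡ n ℕ.+ suc (suc n)
    1+p≡n+[n+2] = sym (trans (ℕP.+-suc n (suc n)) (cong suc (ℕP.+-suc n n)))
    below : ∀ k → k < n → odd-term p k ≡ + 0 mod + p
    below k k<n = *-zeroˡ-mod ((- + 3) ℤ.^ k) (pCk≡0 (s≤s z≤n) (s≤s (ℕP.+-mono-< k<n k<n)))
    at-n : odd-term p (n ℕ.+ 0) ≡ (- + 3) ℤ.^ n
    at-n rewrite ℕP.+-identityʳ n = trans (cong (λ c → + c * (- + 3) ℤ.^ n) (nCn≡1 p)) (ℤP.*-identityˡ _)
    above : ∀ i → odd-term p (n ℕ.+ suc i) ≡ + 0
    above i = cong (λ c → + c * (- + 3) ℤ.^ (n ℕ.+ suc i)) (k>n⇒nCk≡0 (s≤s (ℕP.+-mono-< n<n+1+i n<n+1+i)))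
      where
      n<n+1+i : n < n ℕ.+ suc i
      n<n+1+i = ℕP.m<m+n n (s≤s z≤n)

  -- 2n = p - 1 is 3k or 3k + 1 according to p mod 3, and (-8)ᵏ = (-2)³ᵏ.
  [-2]^[p-1]≡1 : (- + 2) ℤ.^ (n ℕ.+ n) ≡ + 1 mod + p
  [-2]^[p-1]≡1 = begin
    (- + 2) ℤ.^ (n ℕ.+ n)                    ≡⟨ ^-distribʳ-* (+ 2) -1ℤ (n ℕ.+ n) ⟩
    (+ 2) ℤ.^ (n ℕ.+ n) * sign (n ℕ.+ n)     ≡⟨ trans (cong ((+ 2) ℤ.^ (n ℕ.+ n) *_) (sign-even n)) (ℤP.*-identityʳ _) ⟩
    (+ 2) ℤ.^ (n ℕ.+ n)                      ≈⟨ fermat-unit (s≤s z≤n) (ℕP.<-trans (ℕP.n<1+n 2) 3<p) ⟩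
    + 1                                      ∎
    where open ≡-mod-Reasoning (+ p)

  [-3]^n≡t*sign : (- + 3) ℤ.^ n ≡ t * sign n
  [-3]^n≡t*sign = ^-distribʳ-* (+ 3) -1ℤ n

  p≡1[3]⇒ε≡1 : p % 3 ≡ 1 → t * sign n ≡ + 1 mod + p
  p≡1[3]⇒ε≡1 p%3≡1 = begin
    t * sign n                   ≡⟨ [-3]^n≡t*sign ⟨
    (- + 3) ℤ.^ n                ≈⟨ v-p ⟨
    v p                          ≡⟨ cong v p≡1+3k ⟩
    v (suc (k ℕ.* 3))            ≡⟨ v-1+3k k ⟩
    (- + 2) ℤ.^ (k ℕ.* 3)        ≡⟨ cong ((- + 2) ℤ.^_) (ℕP.suc-injective p≡1+3k) ⟨
    (- + 2) ℤ.^ (n ℕ.+ n)        ≈⟨ [-2]^[p-1]≡1 ⟩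
    + 1                          ∎
    where
    open ≡-mod-Reasoning (+ p)
    k : ℕ
    k = p ℕ./ 3
    p≡1+3k : p ≡ suc (k ℕ.* 3)
    p≡1+3k = trans (m≡m%n+[m/n]*n p 3) (cong (ℕ._+ k ℕ.* 3) p%3≡1)

  p≡2[3]⇒ε≡-1 : p % 3 ≡ 2 → t * sign n ≡ - + 1 mod + p
  p≡2[3]⇒ε≡-1 p%3≡2 = begin
    t * sign n                      ≡⟨ [-3]^n≡t*sign ⟨
    (- + 3) ℤ.^ n                   ≈⟨ v-p ⟨
    v p                             ≡⟨ cong v p≡2+3k ⟩
    v (suc (suc (k ℕ.* 3)))         ≡⟨ v-2+3k k ⟩
    - (- + 2) ℤ.^ suc (k ℕ.* 3)     ≡⟨ cong (λ e → - (- + 2) ℤ.^ e) (ℕP.suc-injective p≡2+3k) ⟨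
    - (- + 2) ℤ.^ (n ℕ.+ n)         ≈⟨ neg-mod-cong [-2]^[p-1]≡1 ⟩
    - + 1                           ∎
    where
    open ≡-mod-Reasoning (+ p)
    k : ℕ
    k = p ℕ./ 3
    p≡2+3k : p ≡ suc (suc (k ℕ.* 3))
    p≡2+3k = trans (m≡m%n+[m/n]*n p 3) (cong (ℕ._+ k ℕ.* 3) p%3≡2)

  weighted-sum≡p*3^p : p % 3 ≡ 1 → weighted-sum p ≡ + p * + (3 ^ p) mod (+ p * + p)
  weighted-sum≡p*3^p p%3≡1 = begin
    weighted-sum p      ≡⟨ weighted-sum≡p*∑f ⟩
    + p * ∑< p f        ≈⟨ *-mod-scale (+ p) (∑f≡3^p (p≡1[3]⇒ε≡1 p%3≡1)) ⟩
    + p * (+ 3) ℤ.^ p   ≡⟨ cong (+ p *_) (pos-^ 3 p) ⟨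
    + p * + (3 ^ p)     ∎
    where open ≡-mod-Reasoning (+ p * + p)

  weighted-sum≡0 : p % 3 ≡ 2 → weighted-sum p ≡ + 0 mod (+ p * + p)
  weighted-sum≡0 p%3≡2 = begin
    weighted-sum p      ≡⟨ weighted-sum≡p*∑f ⟩
    + p * ∑< p f        ≈⟨ *-mod-scale (+ p) (∑f≡0 (p≡2[3]⇒ε≡-1 p%3≡2)) ⟩
    + p * + 0           ≡⟨ ℤP.*-zeroʳ (+ p) ⟩
    + 0                 ∎
    where open ≡-mod-Reasoning (+ p * + p)

module _ {p : ℕ} (isPrime : Prime p) where

  ∤-* : ∀ {m n} → ¬ (p ∣ℕ m) → ¬ (p ∣ℕ n) → ¬ (p ∣ℕ m ℕ.* n)
  ∤-* {m} {n} p∤m p∤n p∣mn with euclidsLemma m n isPrime p∣mn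
  ... | inj₁ p∣m = p∤m p∣m
  ... | inj₂ p∣n = p∤n p∣n

  p²∣m*n⇒p²∣m : ∀ {m n} → p ℕ.* p ∣ℕ m ℕ.* n → ¬ (p ∣ℕ n) → p ℕ.* p ∣ℕ m
  p²∣m*n⇒p²∣m {m} {n} p²∣mn p∤n with euclidsLemma m n isPrime (ℕD.∣-trans (ℕD.m∣m*n p) p²∣mn)
  ... | inj₂ p∣n = ⊥-elim (p∤n p∣n)
  ... | inj₁ (ℕD.divides k m≡kp)
    with euclidsLemma k n isPrime (ℕD.*-cancelˡ-∣ p {{prime⇒nonZero isPrime}} (subst (p ℕ.* p ∣ℕ_) mn≡p[kn] p²∣mn))
    where
    mn≡p[kn] : m ℕ.* n ≡ p ℕ.* (k ℕ.* n)
    mn≡p[kn] = trans (cong (ℕ._* n) m≡kp) (swap k p n)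
      where
      swap : ∀ k p n → k ℕ.* p ℕ.* n ≡ p ℕ.* (k ℕ.* n)
      swap = ℕ-solve-∀
  ...   | inj₂ p∣n = ⊥-elim (p∤n p∣n)
  ...   | inj₁ (ℕD.divides l k≡lp) = ℕD.divides l (trans m≡kp (trans (cong (ℕ._* p) k≡lp) (ℕP.*-assoc l p p)))

  ∣↥∣*b≡∣a∣*↧ : ∀ {q a b} → q ≃ a / b → ∣ ↥ q ∣ ℕ.* b ≡ ∣ a ∣ ℕ.* ↧ₙ q
  ∣↥∣*b≡∣a∣*↧ {q} {a} {b} (cross-multiplied ↥q*b≡a*↧q) =
    trans (sym (ℤP.abs-* (↥ q) (+ b))) (trans (cong ∣_∣ ↥q*b≡a*↧q) (ℤP.abs-* a (↧ q)))

  ≃-denominator : ∀ {q a b} → q ≃ a / b → ¬ (p ∣ℕ b) → ¬ (p ∣ℕ ↧ₙ q)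
  ≃-denominator {q@(mkℚ _ _ coprime)} {a} {b} q≃a/b p∤b p∣↧q
    with euclidsLemma ∣ ↥ q ∣ b isPrime (subst (p ∣ℕ_) (sym (∣↥∣*b≡∣a∣*↧ q≃a/b)) (ℕD.∣n⇒∣m*n ∣ a ∣ p∣↧q))
  ... | inj₁ p∣↥q = ℕ.nonTrivial⇒≢1 {{prime⇒nonTrivial isPrime}} (Coprimality.recompute coprime (p∣↥q , p∣↧q))
  ... | inj₂ p∣b = p∤b p∣b

  ≃-numerator : ∀ {q a b} → q ≃ a / b → p ℕ.* p ∣ℕ ∣ a ∣ → ¬ (p ∣ℕ b) → p ℕ.* p ∣ℕ ∣ ↥ q ∣
  ≃-numerator {q} {a} q≃a/b p²∣a =
    p²∣m*n⇒p²∣m (subst (p ℕ.* p ∣ℕ_) (sym (∣↥∣*b≡∣a∣*↧ q≃a/b)) (ℕD.∣m⇒∣m*n (↧ₙ q) p²∣a))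

  CongMod-≃ : ∀ {q r a b c d} → q ≃ a / b → r ≃ c / d → ¬ (p ∣ℕ b) → ¬ (p ∣ℕ d) →
              a * + d ≡ c * + b mod (+ p * + p) → CongMod p (p ^ 2) q r
  CongMod-≃ {q} {r} {a} {b} {c} {d} q≃a/b r≃c/d p∤b p∤d (mod-by p²∣ad-cb) =
    ≃-denominator q≃a/b p∤b ,
    ≃-denominator r≃c/d p∤d ,
    subst (_∣ℕ ∣ ↥ (q -ℚ r) ∣) (cong (p ℕ.*_) (sym (ℕP.*-identityʳ p)))
      (≃-numerator (+-≃ q (-ℚ r) q≃a/b (neg-≃ r r≃c/d)) p²∣numerator (∤-* p∤b p∤d))
    where
    p²∣numerator : p ℕ.* p ∣ℕ ∣ a * + d + - c * + b ∣
    p²∣numerator = subst₂ (λ m x → m ∣ℕ ∣ x ∣) (ℤP.abs-* (+ p) (+ p)) (cross-difference a (+ d) c (+ b)) (∣⇒∣ᵤ p²∣ad-cb)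
      where
      cross-difference : ∀ a d c b → a * d - c * b ≡ a * d + - c * b
      cross-difference = solve-∀

  ∤-3^ : 3 < p → ∀ m → ¬ (p ∣ℕ 3 ^ m)
  ∤-3^ 3<p zero p∣1 = ℕ.nonTrivial⇒≢1 {{prime⇒nonTrivial isPrime}} (ℕD.∣1⇒≡1 p∣1)
  ∤-3^ 3<p (suc m) = ∤-* (λ p∣3 → ℕP.<⇒≱ 3<p (ℕD.∣⇒≤ p∣3)) (∤-3^ 3<p m)

odd-prime : ∀ {p} → Prime p → p > 3 → ∃[ n ] (p ≡ suc (n ℕ.+ n) × 2 ≤ n)
odd-prime {p} isPrime p>3 with p % 2 | m≡m%n+[m/n]*n p 2 | m%n<n p 2
... | zero | p≡[p/2]*2 | _ =
  ⊥-elim (Prime.notComposite isPrime (composite {d = 2} (ℕP.<-trans (s≤s (s≤s (s≤s z≤n))) p>3) (ℕD.divides (p ℕ./ 2) p≡[p/2]*2)))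
... | suc zero | p≡1+[p/2]*2 | _ = n , p≡2n+1 , 2≤n (subst (3 <_) p≡2n+1 p>3)
  where
  n : ℕ
  n = p ℕ./ 2
  p≡2n+1 : p ≡ suc (n ℕ.+ n)
  p≡2n+1 = trans p≡1+[p/2]*2 (cong suc (trans (ℕP.*-comm n 2) (cong (n ℕ.+_) (ℕP.+-identityʳ n))))
  2≤n : ∀ {n} → 3 < suc (n ℕ.+ n) → 2 ≤ n
  2≤n {zero} (s≤s ())
  2≤n {suc zero} (s≤s (s≤s (s≤s ())))
  2≤n {suc (suc n)} _ = s≤s (s≤s z≤n)
... | suc (suc _) | _ | s≤s (s≤s ())

theorem1p4 : (p : ℕ) → Prime p → p > 3 →
    ((p % 3 ≡ 1) → CongMod p (p ^ 2) (sumℚ p term) (ℤ.+ p Data.Rational./ 1))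
    × ((p % 3 ≡ 2) → CongMod p (p ^ 2) (sumℚ p term) 0ℚ)
theorem1p4 p isPrime p>3 with odd-prime isPrime p>3
... | n , refl , 2≤n = case-1 , case-2
  where
  open OddPrime n isPrime 2≤n using (3<p; weighted-sum≡p*3^p; weighted-sum≡0)
  p∤3^p : ¬ (p ∣ℕ 3 ^ p)
  p∤3^p = ∤-3^ isPrime 3<p p
  p∤1 : ¬ (p ∣ℕ 1)
  p∤1 = ∤-3^ isPrime 3<p 0
  case-1 : p % 3 ≡ 1 → CongMod p (p ^ 2) (sumℚ p term) (+ p /ℚ 1)
  case-1 p%3≡1 = CongMod-≃ isPrime (sumℚ-term-≃ p) (/-≃ (+ p) 1) p∤3^p p∤1
    (mod-trans (mod-reflexive (ℤP.*-identityʳ (weighted-sum p))) (weighted-sum≡p*3^p p%3≡1))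
  case-2 : p % 3 ≡ 2 → CongMod p (p ^ 2) (sumℚ p term) 0ℚ
  case-2 p%3≡2 = CongMod-≃ isPrime {r = 0ℚ} {c = + 0} {d = 1} (sumℚ-term-≃ p) (cross-multiplied refl) p∤3^p p∤1
    (mod-trans (mod-reflexive (ℤP.*-identityʳ (weighted-sum p)))
      (mod-trans (weighted-sum≡0 p%3≡2) (mod-reflexive (sym (ℤP.*-zeroˡ (+ (3 ^ p)))))))
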